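{- Let $G$ be a finite simple graph with at least one vertex, let $C$ be the set of cheap vertices of $G$, and let $S$ be any maximal independent subset of $G[C]$. Let $B$ be the bipartite graph with partite sets $S$ and $N(S)$ whose edges are all edges of $G$ between $S$ and $N(S)$, and let $B_1,\dots,B_p$ be the connected components of $B$. For each $i$ let $e_i$ be the number of edges of $B_i$, $s_i=|V(B_i)\cap S|$, $t_i=|V(B_i)\cap N(S)|$, and $\lambda_i=1-\frac{e_i}{s_i}+\frac{t_i}{s_i}$. Suppose $\lambda_i\geq 0$ for all $i$. Then $$\alpha(G)\geq \sum_{i=1}^p\ \sum_{v\in N[S\cap V(B_i)]}\frac{1}{\zeta(v)+\lambda_i}+\sum_{v\in V(G)\setminus N[S]}\frac{1}{\zeta(v)+1}.$$
   Context: $\alpha(G)$ is the independence number. For a vertex $v$, $\zeta(v)=\max_H\delta(H)$, the maximum over all subgraphs $H$ of $G$ containing $v$, where $\delta(H)$ is the minimum degree of $H$. For $X\subseteq V(G)$, $N(X)=\bigcup_{v\in X}N(v)$ and $N[X]=N(X)\cup X$; $G[X]$ is the induced subgraph. A vertex $u$ is cheap if $\zeta(u)=\deg_G(u)$ and $\zeta(u)=\min_{v\in N[u]}\zeta(v)$. -}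

module Defs where

open import Data.Bool using (Bool; true; false; _∧_; _∨_; not; if_then_else_)
open import Data.Nat using (ℕ; zero; suc; _≤_; _<_; _<?_)
open import Data.Fin using (Fin; toℕ)
open import Data.Fin.Properties using () renaming (_≟_ to _≟F_)
open import Data.List using (List; map; foldr; allFin)
open import Data.Nat.ListAction using (sum)
open import Data.Bool.ListAction using (any)
open import Data.Product using (Σ; _×_; _,_)
open import Data.Sum using (_⊎_)
open import Data.Integer using (+_)
open import Data.Rational using (ℚ; 0ℚ; 1ℚ; _+_; _-_; _*_; _/_; 1/_; ≢-nonZero)
open import Data.Rational.Properties using () renaming (_≟_ to _≟Q_)
open import Relation.Binary.PropositionalEquality using (_≡_)
open import Relation.Nullary using (yes; no)
open import Relation.Nullary.Decidable using (⌊_⌋)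

record Graph (n : ℕ) : Set where
  field
    adj   : Fin n → Fin n → Bool
    sym   : ∀ u v → adj u v ≡ adj v u
    irrefl : ∀ v → adj v v ≡ false
open Graph public

VSet : ℕ → Set
VSet n = Fin n → Bool

count : ∀ {n} → VSet n → ℕ
count {n} P = sum (map (λ v → if P v then 1 else 0) (allFin n))

anyV : ∀ {n} → VSet n → Bool
anyV {n} P = any P (allFin n)

deg : ∀ {n} → Graph n → Fin n → ℕ
deg G v = count (adj G v)

N : ∀ {n} → Graph n → VSet n → VSet n
N G X v = anyV (λ u → X u ∧ adj G u v)

N[_] : ∀ {n} → Graph n → VSet n → VSet n
N[ G ] X v = N G X v ∨ X v

_⊆_ : ∀ {n} → VSet n → VSet n → Set
X ⊆ Y = ∀ v → X v ≡ true → Y v ≡ true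

Independent : ∀ {n} → Graph n → VSet n → Set
Independent G I = ∀ u v → I u ≡ true → I v ≡ true → adj G u v ≡ false

IsIndependenceNumber : ∀ {n} → Graph n → ℕ → Set
IsIndependenceNumber G a =
  Σ (VSet _) (λ I → Independent G I × count I ≡ a)
  × (∀ I → Independent G I → count I ≤ a)

-- a (not necessarily induced) subgraph H of G: vertex set W, edge set F
record Subgraph {n} (G : Graph n) : Set where
  field
    W     : VSet n
    F     : Fin n → Fin n → Bool
    F-sym : ∀ u v → F u v ≡ F v u
    F⊆E   : ∀ u v → F u v ≡ true → adj G u v ≡ true
    F⊆W   : ∀ u v → F u v ≡ true → W u ≡ true
open Subgraph public

degH : ∀ {n} {G : Graph n} → Subgraph G → Fin n → ℕ
degH H v = count (F H v)

IsMinDeg : ∀ {n} {G : Graph n} → Subgraph G → ℕ → Set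
IsMinDeg H d =
  Σ (Fin _) (λ w → W H w ≡ true × degH H w ≡ d)
  × (∀ w → W H w ≡ true → d ≤ degH H w)

IsZeta : ∀ {n} → Graph n → Fin n → ℕ → Set
IsZeta G v k =
  Σ (Subgraph G) (λ H → W H v ≡ true × IsMinDeg H k)
  × (∀ (H : Subgraph G) d → W H v ≡ true → IsMinDeg H d → d ≤ k)

-- u is cheap (w.r.t. the function ζ): ζ(u) = deg(u) and ζ(u) = min_{v ∈ N[u]} ζ(v)
-- (since u ∈ N[u], the latter is: ζ(u) ≤ ζ(v) for every v ∈ N[u])
Cheap : ∀ {n} → Graph n → (Fin n → ℕ) → Fin n → Set
Cheap G ζ u = ζ u ≡ deg G u × (∀ v → (v ≡ u ⊎ adj G u v ≡ true) → ζ u ≤ ζ v)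

MaximalIndepInCheap : ∀ {n} → Graph n → (Fin n → ℕ) → VSet n → Set
MaximalIndepInCheap G ζ S =
  (∀ v → S v ≡ true → Cheap G ζ v) × Independent G S
  × (∀ T → S ⊆ T → (∀ v → T v ≡ true → Cheap G ζ v) → Independent G T → T ⊆ S)

inB : ∀ {n} → Graph n → VSet n → VSet n
inB G S v = S v ∨ N G S v

edgeB : ∀ {n} → Graph n → VSet n → Fin n → Fin n → Bool
edgeB G S u v = adj G u v ∧ ((S u ∧ N G S v) ∨ (S v ∧ N G S u))

data Walk {n} (G : Graph n) (S : VSet n) : Fin n → Fin n → Set where
  here : ∀ {u} → Walk G S u u
  step : ∀ {u v w} → edgeB G S u v ≡ true → Walk G S v w → Walk G S u w

-- comp labels the connected components of B by Fin p:
-- two vertices of B get the same label iff they are connected in B,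
-- and every label is used (so B_1,…,B_p are exactly the components).
IsComponentLabelling : ∀ {n} → Graph n → VSet n → (p : ℕ) → (Fin n → Fin p) → Set
IsComponentLabelling G S p comp =
  (∀ u v → inB G S u ≡ true → inB G S v ≡ true →
     (comp u ≡ comp v → Walk G S u v) × (Walk G S u v → comp u ≡ comp v))
  × (∀ i → Σ (Fin _) (λ u → inB G S u ≡ true × comp u ≡ i))

VB : ∀ {n p} → Graph n → VSet n → (Fin n → Fin p) → Fin p → VSet n
VB G S comp i v = inB G S v ∧ ⌊ comp v ≟F i ⌋

-- e_i : number of edges of B_i (unordered pairs, counted once via u < v)
eB : ∀ {n p} → Graph n → VSet n → (Fin n → Fin p) → Fin p → ℕ
eB {n} G S comp i =
  sum (map (λ u → count (λ v → ⌊ toℕ u <? toℕ v ⌋ ∧ edgeB G S u v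
                                 ∧ VB G S comp i u ∧ VB G S comp i v))
           (allFin n))

sB : ∀ {n p} → Graph n → VSet n → (Fin n → Fin p) → Fin p → ℕ
sB G S comp i = count (λ v → VB G S comp i v ∧ S v)

tB : ∀ {n p} → Graph n → VSet n → (Fin n → Fin p) → Fin p → ℕ
tB G S comp i = count (λ v → VB G S comp i v ∧ N G S v)

ℕ→ℚ : ℕ → ℚ
ℕ→ℚ k = + k / 1

-- total reciprocal, with the convention inv 0 = 0
inv : ℚ → ℚ
inv q with q ≟Q 0ℚ
... | yes _ = 0ℚ
... | no q≢0 = 1/_ q {{≢-nonZero q≢0}}

sumℚ : ∀ {A : Set} → List A → (A → ℚ) → ℚ
sumℚ xs f = foldr (λ x acc → f x + acc) 0ℚ xs

sumV : ∀ {n} → VSet n → (Fin n → ℚ) → ℚ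
sumV {n} P f = sumℚ (allFin n) (λ v → if P v then f v else 0ℚ)

lam : ∀ {n p} → Graph n → VSet n → (Fin n → Fin p) → Fin p → ℚ
lam G S comp i =
  1ℚ - ℕ→ℚ (eB G S comp i) * inv (ℕ→ℚ (sB G S comp i))
     + ℕ→ℚ (tB G S comp i) * inv (ℕ→ℚ (sB G S comp i))

bound : ∀ {n p} → Graph n → (Fin n → ℕ) → VSet n → (Fin n → Fin p) → ℚ
bound {n} {p} G ζ S comp =
  sumℚ (allFin p) (λ i →
    sumV (N[ G ] (λ v → S v ∧ VB G S comp i v))
         (λ v → inv (ℕ→ℚ (ζ v) + lam G S comp i)))
  + sumV (λ v → not (N[ G ] S v)) (λ v → inv (ℕ→ℚ (ζ v) + 1ℚ))

-- S together with any independent set I ⊆ V(G) ∖ N[S] is independent, so it suffices to bound the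
-- sum over V(G) ∖ N[S] by |I| and the sum over N[S ∩ V(Bᵢ)] by sᵢ, since Σᵢ sᵢ = |S|.
--
-- For the first bound, starting from X = V(G) ∖ N[S], put a vertex v of minimum degree d in G[X]
-- into I and remove N[v] ∩ X from X. The subgraph G[X] witnesses ζ(u) ≥ d for every u ∈ X, so the
-- d + 1 removed vertices have total weight at most 1.
--
-- For the component Bᵢ, root a breadth-first search tree of Bᵢ at a vertex r ∈ Sᵢ = S ∩ V(Bᵢ) of
-- maximum degree and charge every w ∈ N(Sᵢ) to its parent φ(w) ∈ Sᵢ. Cheapness gives
-- ζ(w) ≥ ζ(φ w) = deg(φ w), so the sum over N[Sᵢ] is at most Σ_{u ∈ Sᵢ} aᵤ / bᵤ with
-- aᵤ = 1 + |φ⁻¹(u)| and bᵤ = deg(u) + λᵢ. Every u ≠ r has aᵤ ≤ bᵤ, because the parent of u is a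
-- neighbour not charged to u; bᵤ ≤ bᵣ; and Σ aᵤ = sᵢ + tᵢ ≤ eᵢ + λᵢ sᵢ ≤ Σ bᵤ by the definition
-- of λᵢ. Summing aᵤ / bᵤ + bᵤ / bᵣ ≤ 1 + aᵤ / bᵣ over Sᵢ then gives Σ aᵤ / bᵤ ≤ sᵢ.

module Submission where

open import Defs
open import Data.Nat using (ℕ; _<_)
open import Data.Fin using (Fin)
open import Data.Rational using (_≤_; 0ℚ)

open import Algebra.Bundles using (Ring)
import Algebra.Properties.Semiring.Sum as SemiringSum
open import Data.Bool using (Bool; true; false; _∧_; _∨_; not; if_then_else_) renaming (_≟_ to _≟B_)
import Data.Bool.Properties as Boolₚ
open import Data.Bool.Properties using (¬-not; T-≡)
open import Data.Empty using (⊥; ⊥-elim)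
open import Data.Fin using (zero; suc; toℕ)
open import Data.Fin.Properties using () renaming (_≟_ to _≟F_)
import Data.Integer as ℤ
import Data.Integer.Properties as ℤₚ
open import Data.List using (List; map; tabulate; allFin; filter)
open import Data.List.Membership.Propositional using (_∈_; lose)
open import Data.List.Membership.Propositional.Properties using (∈-filter⁺; ∈-allFin)
open import Data.List.Properties using (map-cong)
open import Data.List.Relation.Unary.All as All using (All)
open import Data.List.Relation.Unary.All.Properties using (all-filter)
open import Data.List.Relation.Unary.Any using (satisfied)
open import Data.List.Relation.Unary.Any.Properties using (any⁺; any⁻)
open import Data.Nat as ℕ using (z≤n; s≤s)
import Data.Nat.Coprimality as Coprimality
open import Data.Nat.Induction using (<-wellFounded)
open import Data.Nat.ListAction using (sum)
import Data.Nat.Properties as ℕₚ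
import Data.List.Extrema ℕₚ.≤-totalOrder as Extrema
open import Data.Product using (Σ; _×_; _,_; proj₁; proj₂)
open import Data.Rational as ℚ using (ℚ; 1ℚ; _+_; _*_; _-_; -_)
import Data.Rational.Properties as ℚₚ
open import Data.Rational.Properties using () renaming (_≟_ to _≟Q_)
open import Data.Rational.Solver using (module +-*-Solver)
open import Data.Sum using (_⊎_; inj₁; inj₂; [_,_]′) renaming (map to ⊎-map)
open import Function using (_∘_)
open import Function.Bundles using (Equivalence)
import Induction.WellFounded as WF
import Relation.Binary.Construct.On as On
open import Relation.Binary.PropositionalEquality as ≡
  using (_≡_; _≢_; refl; trans; cong; cong₂; subst; module ≡-Reasoning)
open import Relation.Nullary using (yes; no)
open import Relation.Nullary.Decidable using (⌊_⌋)

-- Boolean vertex sets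

∧-true⁻ˡ : ∀ {a b} → a ∧ b ≡ true → a ≡ true
∧-true⁻ˡ {true} _ = refl

∧-true⁻ʳ : ∀ {a b} → a ∧ b ≡ true → b ≡ true
∧-true⁻ʳ {true} b≡true = b≡true

∧-true⁺ : ∀ {a b} → a ≡ true → b ≡ true → a ∧ b ≡ true
∧-true⁺ refl refl = refl

∨-true⁻ : ∀ {a b} → a ∨ b ≡ true → a ≡ true ⊎ b ≡ true
∨-true⁻ {true} _ = inj₁ refl
∨-true⁻ {false} b≡true = inj₂ b≡true

∨-true⁺ˡ : ∀ {a} b → a ≡ true → a ∨ b ≡ true
∨-true⁺ˡ _ refl = refl

∨-true⁺ʳ : ∀ a {b} → b ≡ true → a ∨ b ≡ true
∨-true⁺ʳ true _ = refl
∨-true⁺ʳ false b≡true = b≡true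

not-true⁻ : ∀ {a} → not a ≡ true → a ≡ false
not-true⁻ {false} _ = refl

true≢false : true ≢ false
true≢false ()

≡-from-⇔ : ∀ {a b} → (a ≡ true → b ≡ true) → (b ≡ true → a ≡ true) → a ≡ b
≡-from-⇔ {false} {false} _ _ = refl
≡-from-⇔ {false} {true} _ b⇒a = b⇒a refl
≡-from-⇔ {true} {false} a⇒b _ = ≡.sym (a⇒b refl)
≡-from-⇔ {true} {true} _ _ = refl

≟-refl : ∀ {n} (v : Fin n) → ⌊ v ≟F v ⌋ ≡ true
≟-refl v with v ≟F v
... | yes _ = refl
... | no v≢v = ⊥-elim (v≢v refl)

≟-true⁻ : ∀ {n} {u v : Fin n} → ⌊ u ≟F v ⌋ ≡ true → u ≡ v
≟-true⁻ {u = u} {v} _ with u ≟F v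
... | yes u≡v = u≡v

≟-false : ∀ {n} {u v : Fin n} → u ≢ v → ⌊ u ≟F v ⌋ ≡ false
≟-false {u = u} {v} u≢v with u ≟F v
... | yes u≡v = ⊥-elim (u≢v u≡v)
... | no _ = refl

anyV-true⁻ : ∀ {n} {P : VSet n} → anyV P ≡ true → Σ (Fin n) λ v → P v ≡ true
anyV-true⁻ {n} {P} any≡true with satisfied (any⁻ P (allFin n) (Equivalence.from T-≡ any≡true))
... | v , Pv = v , Equivalence.to T-≡ Pv

anyV-true⁺ : ∀ {n} {P : VSet n} v → P v ≡ true → anyV P ≡ true
anyV-true⁺ {n} {P} v Pv = Equivalence.to T-≡ (any⁺ P (lose (∈-allFin v) (Equivalence.from T-≡ Pv)))

empty-or-inhabited : ∀ {n} (X : VSet n) → (∀ v → X v ≡ false) ⊎ Σ (Fin n) λ v → X v ≡ true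
empty-or-inhabited X with anyV X in any-X
... | true = inj₂ (anyV-true⁻ any-X)
... | false = inj₁ (λ v → ¬-not (λ Xv → true≢false (trans (≡.sym (anyV-true⁺ v Xv)) any-X)))

∅ : ∀ {n} → VSet n
∅ _ = false

∪-⊆ : ∀ {n} {P Q R : VSet n} → P ⊆ R → Q ⊆ R → (λ v → P v ∨ Q v) ⊆ R
∪-⊆ {P = P} P⊆R Q⊆R v v∈ with ∨-true⁻ {P v} v∈
... | inj₁ Pv = P⊆R v Pv
... | inj₂ Qv = Q⊆R v Qv

single-⊆ : ∀ {n} {R : VSet n} {v} → R v ≡ true → (λ u → ⌊ v ≟F u ⌋) ⊆ R
single-⊆ {R = R} Rv u v≡u = subst (λ x → R x ≡ true) (≟-true⁻ v≡u) Rv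

count-cong : ∀ {n} {P Q : VSet n} → (∀ v → P v ≡ Q v) → count P ≡ count Q
count-cong {n} P≗Q = cong sum (map-cong (λ v → cong (λ b → if b then 1 else 0) (P≗Q v)) (allFin n))

-- Rational arithmetic

0<1 : 0ℚ ℚ.< 1ℚ
0<1 = ℚₚ.positive⁻¹ 1ℚ

0≤1 : 0ℚ ≤ 1ℚ
0≤1 = ℚₚ.<⇒≤ 0<1

p≤p+q : ∀ p {q} → 0ℚ ≤ q → p ≤ p + q
p≤p+q p {q} 0≤q = subst (_≤ p + q) (ℚₚ.+-identityʳ p) (ℚₚ.+-monoʳ-≤ p 0≤q)

ℕ→ℚ-nonNeg : ∀ k → 0ℚ ≤ ℕ→ℚ k
ℕ→ℚ-nonNeg k = ℚₚ.nonNegative⁻¹ _ {{ℚₚ.normalize-nonNeg k 1}}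

ℕ→ℚ-mkℚ : ∀ k → ℕ→ℚ k ≡ ℚ.mkℚ (ℤ.+ k) 0 (Coprimality.sym (Coprimality.1-coprimeTo k))
ℕ→ℚ-mkℚ k = ℚₚ.↥p/↧p≡p _

ℕ→ℚ-+ : ∀ m n → ℕ→ℚ (m ℕ.+ n) ≡ ℕ→ℚ m + ℕ→ℚ n
ℕ→ℚ-+ m n rewrite ℕ→ℚ-mkℚ m | ℕ→ℚ-mkℚ n =
  cong (ℚ._/ 1) (trans (ℤₚ.pos-+ m n)
    (≡.sym (cong₂ ℤ._+_ (ℤₚ.*-identityʳ (ℤ.+ m)) (ℤₚ.*-identityʳ (ℤ.+ n)))))

ℕ→ℚ-mono-≤ : ∀ {m n} → m ℕ.≤ n → ℕ→ℚ m ≤ ℕ→ℚ n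
ℕ→ℚ-mono-≤ {m} m≤n with ℕₚ.m≤n⇒∃[o]m+o≡n m≤n
... | o , refl = begin
  ℕ→ℚ m           ≤⟨ p≤p+q (ℕ→ℚ m) (ℕ→ℚ-nonNeg o) ⟩
  ℕ→ℚ m + ℕ→ℚ o   ≡⟨ ℕ→ℚ-+ m o ⟨
  ℕ→ℚ (m ℕ.+ o)   ∎
  where open ℚₚ.≤-Reasoning

ℕ→ℚ-cancel-< : ∀ {m n} → 1ℚ + ℕ→ℚ m ≤ ℕ→ℚ n → m < n
ℕ→ℚ-cancel-< {m} {n} 1+m≤n with m ℕ.<? n
... | yes m<n = m<n
... | no m≮n = ⊥-elim (ℚₚ.<-irrefl refl (ℚₚ.<-≤-trans m<1+m (ℚₚ.≤-trans 1+m≤n (ℕ→ℚ-mono-≤ (ℕₚ.≮⇒≥ m≮n)))))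
  where
  m<1+m : ℕ→ℚ m ℚ.< 1ℚ + ℕ→ℚ m
  m<1+m = subst (ℚ._< 1ℚ + ℕ→ℚ m) (ℚₚ.+-identityˡ (ℕ→ℚ m)) (ℚₚ.+-monoˡ-< (ℕ→ℚ m) 0<1)

ℕ→ℚ+1-pos : ∀ k → 0ℚ ℚ.< ℕ→ℚ k + 1ℚ
ℕ→ℚ+1-pos k = ℚₚ.<-≤-trans 0<1 (subst (_≤ ℕ→ℚ k + 1ℚ) (ℚₚ.+-identityˡ 1ℚ) (ℚₚ.+-monoˡ-≤ 1ℚ (ℕ→ℚ-nonNeg k)))

p≤q⇒0≤q-p : ∀ {p q} → p ≤ q → 0ℚ ≤ q - p
p≤q⇒0≤q-p {p} {q} p≤q = subst (_≤ q - p) (ℚₚ.+-inverseʳ p) (ℚₚ.+-monoˡ-≤ (- p) p≤q)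

+-cancelʳ-≤ : ∀ {x y z} → x + y ≤ z + y → x ≤ z
+-cancelʳ-≤ {x} {y} {z} x+y≤z+y = begin
  x            ≡⟨ solve 2 (λ x y → x := x :+ y :- y) refl x y ⟩
  x + y - y    ≤⟨ ℚₚ.+-monoˡ-≤ (- y) x+y≤z+y ⟩
  z + y - y    ≡⟨ solve 2 (λ z y → z :+ y :- y := z) refl z y ⟩
  z            ∎
  where
  open ℚₚ.≤-Reasoning
  open +-*-Solver

*-inv : ∀ {q} → q ≢ 0ℚ → q * inv q ≡ 1ℚ
*-inv {q} q≢0 with q ≟Q 0ℚ
... | yes q≡0 = ⊥-elim (q≢0 q≡0)
... | no q≢0′ = ℚₚ.*-inverseʳ q {{ℚ.≢-nonZero q≢0′}}

-- No hypothesis on q is needed: at q = 0 the product is 0, since inv 0 = 0.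
*-inv-≤-1 : ∀ q → q * inv q ≤ 1ℚ
*-inv-≤-1 q with q ≟Q 0ℚ
... | yes refl = 0≤1
... | no q≢0 = ℚₚ.≤-reflexive (ℚₚ.*-inverseʳ q {{ℚ.≢-nonZero q≢0}})

inv-nonNeg : ∀ {q} → 0ℚ ≤ q → 0ℚ ≤ inv q
inv-nonNeg {q} 0≤q with q ≟Q 0ℚ
... | yes _ = ℚₚ.≤-refl
... | no q≢0 = ℚₚ.<⇒≤ (ℚₚ.positive⁻¹ _ {{ℚₚ.1/pos⇒pos q {{q-pos}}}})
  where
  instance
    q-nonZero = ℚ.≢-nonZero q≢0
    q-nonNeg = ℚ.nonNegative 0≤q
  q-pos = ℚₚ.nonNeg∧nonZero⇒pos q

inv-antitone : ∀ {p q} → 0ℚ ℚ.< p → p ≤ q → inv q ≤ inv p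
inv-antitone {p} {q} 0<p p≤q = begin
  inv q                  ≡⟨ ℚₚ.*-identityʳ (inv q) ⟨
  inv q * 1ℚ             ≡⟨ cong (inv q *_) (*-inv p≢0) ⟨
  inv q * (p * inv p)    ≤⟨ ℚₚ.*-monoˡ-≤-nonNeg (inv q) {{ℚ.nonNegative (inv-nonNeg 0≤q)}}
                              (ℚₚ.*-monoʳ-≤-nonNeg (inv p) {{ℚ.nonNegative (inv-nonNeg 0≤p)}} p≤q) ⟩
  inv q * (q * inv p)    ≡⟨ ℚₚ.*-assoc (inv q) q (inv p) ⟨
  inv q * q * inv p      ≡⟨ cong (_* inv p) (trans (ℚₚ.*-comm (inv q) q) (*-inv q≢0)) ⟩
  1ℚ * inv p             ≡⟨ ℚₚ.*-identityˡ (inv p) ⟩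
  inv p                  ∎
  where
  open ℚₚ.≤-Reasoning
  0≤p = ℚₚ.<⇒≤ 0<p
  0≤q = ℚₚ.≤-trans 0≤p p≤q
  p≢0 = λ p≡0 → ℚₚ.<-irrefl (≡.sym p≡0) 0<p
  q≢0 = λ q≡0 → ℚₚ.<-irrefl (≡.sym q≡0) (ℚₚ.<-≤-trans 0<p p≤q)

s*[1-e/s+t/s]≡s-e+t : ∀ s e t → s ≢ 0ℚ → s * (1ℚ - e * inv s + t * inv s) ≡ s - e + t
s*[1-e/s+t/s]≡s-e+t s e t s≢0 = begin
  s * (1ℚ - e * inv s + t * inv s)             ≡⟨ solve 4 (λ s e t i → s :* (con 1ℚ :- e :* i :+ t :* i) := s :- e :* (s :* i) :+ t :* (s :* i))
                                                     refl s e t (inv s) ⟩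
  s - e * (s * inv s) + t * (s * inv s)        ≡⟨ cong (λ x → s - e * x + t * x) (*-inv s≢0) ⟩
  s - e * 1ℚ + t * 1ℚ                          ≡⟨ cong₂ (λ x y → s - x + y) (ℚₚ.*-identityʳ e) (ℚₚ.*-identityʳ t) ⟩
  s - e + t                                    ∎
  where
  open ≡-Reasoning
  open +-*-Solver

exchange : ∀ {a b B} → 0ℚ ℚ.< a → a ≤ b → b ≤ B → a * inv b + b * inv B ≤ 1ℚ + a * inv B
exchange {a} {b} {B} 0<a a≤b b≤B = begin
  a * β + b * c                          ≤⟨ p≤p+q (a * β + b * c) 0≤product ⟩
  a * β + b * c + (b - a) * (β - c)      ≡⟨ solve 4 (λ a b β c → a :* β :+ b :* c :+ (b :- a) :* (β :- c) := b :* β :+ a :* c)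
                                                   refl a b β c ⟩
  b * β + a * c                          ≡⟨ cong (_+ a * c) (*-inv b≢0) ⟩
  1ℚ + a * c                             ∎
  where
  open ℚₚ.≤-Reasoning
  open +-*-Solver
  β = inv b
  c = inv B
  0<b = ℚₚ.<-≤-trans 0<a a≤b
  b≢0 = λ b≡0 → ℚₚ.<-irrefl (≡.sym b≡0) 0<b
  0≤product : 0ℚ ≤ (b - a) * (β - c)
  0≤product = ℚₚ.nonNegative⁻¹ _ {{ℚₚ.nonNeg*nonNeg⇒nonNeg (b - a) {{ℚ.nonNegative (p≤q⇒0≤q-p a≤b)}}
                                      (β - c) {{ℚ.nonNegative (p≤q⇒0≤q-p (inv-antitone 0<b b≤B))}}}}

exchange-root : ∀ a b → a * inv b + b * inv b ≤ 1ℚ + a * inv b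
exchange-root a b = begin
  a * inv b + b * inv b    ≤⟨ ℚₚ.+-monoʳ-≤ (a * inv b) (*-inv-≤-1 b) ⟩
  a * inv b + 1ℚ           ≡⟨ ℚₚ.+-comm (a * inv b) 1ℚ ⟩
  1ℚ + a * inv b           ∎
  where open ℚₚ.≤-Reasoning

-- Sums over vertex sets

module ℚΣ = SemiringSum (Ring.semiring ℚₚ.+-*-ring)

≡-if-0 : ∀ b {x : ℚ} → (b ≡ false → x ≡ 0ℚ) → x ≡ (if b then x else 0ℚ)
≡-if-0 true _ = refl
≡-if-0 false x≡0 = x≡0 refl

sumℚ-allFin : ∀ {n} (h : Fin n → ℚ) → sumℚ (allFin n) h ≡ ℚΣ.sum h
sumℚ-allFin h = sumℚ-tabulate (λ v → v)
  where
  sumℚ-tabulate : ∀ {n} (g : Fin n → Fin _) → sumℚ (tabulate g) h ≡ ℚΣ.sum (h ∘ g)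
  sumℚ-tabulate {ℕ.zero} g = refl
  sumℚ-tabulate {ℕ.suc n} g = cong (h (g zero) +_) (sumℚ-tabulate (g ∘ suc))

ℕ→ℚ-sum : ∀ {n} (h : Fin n → ℕ) → ℕ→ℚ (sum (map h (allFin n))) ≡ ℚΣ.sum (ℕ→ℚ ∘ h)
ℕ→ℚ-sum h = sum-tabulate (λ v → v)
  where
  sum-tabulate : ∀ {n} (g : Fin n → Fin _) → ℕ→ℚ (sum (map h (tabulate g))) ≡ ℚΣ.sum (ℕ→ℚ ∘ h ∘ g)
  sum-tabulate {ℕ.zero} g = refl
  sum-tabulate {ℕ.suc n} g = trans (ℕ→ℚ-+ (h (g zero)) _) (cong (ℕ→ℚ (h (g zero)) +_) (sum-tabulate (g ∘ suc)))

sumV≡∑ : ∀ {n} (P : VSet n) (f : Fin n → ℚ) → sumV P f ≡ ℚΣ.sum (λ v → if P v then f v else 0ℚ)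
sumV≡∑ P f = sumℚ-allFin (λ v → if P v then f v else 0ℚ)

∑-mono-≤ : ∀ {n} {f g : Fin n → ℚ} → (∀ v → f v ≤ g v) → ℚΣ.sum f ≤ ℚΣ.sum g
∑-mono-≤ {ℕ.zero} _ = ℚₚ.≤-refl
∑-mono-≤ {ℕ.suc n} f≤g = ℚₚ.+-mono-≤ (f≤g zero) (∑-mono-≤ (f≤g ∘ suc))

∑-single : ∀ {n} (c : Fin n) (f : Fin n → ℚ) → ℚΣ.sum (λ i → if ⌊ c ≟F i ⌋ then f i else 0ℚ) ≡ f c
∑-single {ℕ.suc n} zero f = begin
  f zero + ℚΣ.sum {n} (λ _ → 0ℚ)  ≡⟨ cong (f zero +_) (ℚΣ.sum-replicate-zero n) ⟩
  f zero + 0ℚ                     ≡⟨ ℚₚ.+-identityʳ (f zero) ⟩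
  f zero                          ∎
  where open ≡-Reasoning
∑-single {ℕ.suc n} (suc c) f = begin
  0ℚ + ℚΣ.sum (λ i → if ⌊ suc c ≟F suc i ⌋ then f (suc i) else 0ℚ)
    ≡⟨ ℚₚ.+-identityˡ _ ⟩
  ℚΣ.sum (λ i → if ⌊ suc c ≟F suc i ⌋ then f (suc i) else 0ℚ)
    ≡⟨ ℚΣ.sum-cong-≗ (λ i → cong (λ b → if b then f (suc i) else 0ℚ) (suc-≟ c i)) ⟩
  ℚΣ.sum (λ i → if ⌊ c ≟F i ⌋ then f (suc i) else 0ℚ)
    ≡⟨ ∑-single c (f ∘ suc) ⟩
  f (suc c) ∎
  where
  open ≡-Reasoning
  suc-≟ : ∀ {n} (c i : Fin n) → ⌊ suc c ≟F suc i ⌋ ≡ ⌊ c ≟F i ⌋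
  suc-≟ c i with c ≟F i
  ... | yes _ = refl
  ... | no _ = refl

module _ {n : ℕ} where

  sumV-cong : ∀ {P Q : VSet n} {f g : Fin n → ℚ} →
              (∀ v → (if P v then f v else 0ℚ) ≡ (if Q v then g v else 0ℚ)) → sumV P f ≡ sumV Q g
  sumV-cong {P} {Q} {f} {g} eq = begin
    sumV P f                                    ≡⟨ sumV≡∑ P f ⟩
    ℚΣ.sum (λ v → if P v then f v else 0ℚ)      ≡⟨ ℚΣ.sum-cong-≗ eq ⟩
    ℚΣ.sum (λ v → if Q v then g v else 0ℚ)      ≡⟨ sumV≡∑ Q g ⟨
    sumV Q g                                    ∎
    where open ≡-Reasoning

  sumV-congˡ : ∀ {P Q : VSet n} {f : Fin n → ℚ} → (∀ v → P v ≡ Q v) → sumV P f ≡ sumV Q f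
  sumV-congˡ {P} {Q} {f} P≗Q = sumV-cong {P = P} {Q} {f} {f} (λ v → cong (λ b → if b then f v else 0ℚ) (P≗Q v))

  sumV-congʳ : ∀ {P : VSet n} {f g : Fin n → ℚ} → (∀ v → P v ≡ true → f v ≡ g v) → sumV P f ≡ sumV P g
  sumV-congʳ {P} {f} {g} f≗g = sumV-cong {P = P} {P} {f} {g} pointwise
    where
    pointwise : ∀ v → (if P v then f v else 0ℚ) ≡ (if P v then g v else 0ℚ)
    pointwise v with P v in Pv
    ... | true = f≗g v Pv
    ... | false = refl

  sumV-mono : ∀ {P : VSet n} {f g : Fin n → ℚ} → (∀ v → P v ≡ true → f v ≤ g v) → sumV P f ≤ sumV P g
  sumV-mono {P} {f} {g} f≤g = begin
    sumV P f                                    ≡⟨ sumV≡∑ P f ⟩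
    ℚΣ.sum (λ v → if P v then f v else 0ℚ)      ≤⟨ ∑-mono-≤ pointwise ⟩
    ℚΣ.sum (λ v → if P v then g v else 0ℚ)      ≡⟨ sumV≡∑ P g ⟨
    sumV P g                                    ∎
    where
    open ℚₚ.≤-Reasoning
    pointwise : ∀ v → (if P v then f v else 0ℚ) ≤ (if P v then g v else 0ℚ)
    pointwise v with P v in Pv
    ... | true = f≤g v Pv
    ... | false = ℚₚ.≤-refl

  sumV-+-pointwise : ∀ {P Q R : VSet n} {f g h : Fin n → ℚ} →
    (∀ v → (if R v then h v else 0ℚ) ≡ (if P v then f v else 0ℚ) + (if Q v then g v else 0ℚ)) →
    sumV R h ≡ sumV P f + sumV Q g
  sumV-+-pointwise {P} {Q} {R} {f} {g} {h} split = begin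
    sumV R h
      ≡⟨ sumV≡∑ R h ⟩
    ℚΣ.sum (λ v → if R v then h v else 0ℚ)
      ≡⟨ ℚΣ.sum-cong-≗ split ⟩
    ℚΣ.sum (λ v → (if P v then f v else 0ℚ) + (if Q v then g v else 0ℚ))
      ≡⟨ ℚΣ.∑-distrib-+ (λ v → if P v then f v else 0ℚ) (λ v → if Q v then g v else 0ℚ) ⟩
    ℚΣ.sum (λ v → if P v then f v else 0ℚ) + ℚΣ.sum (λ v → if Q v then g v else 0ℚ)
      ≡⟨ cong₂ _+_ (sumV≡∑ P f) (sumV≡∑ Q g) ⟨
    sumV P f + sumV Q g ∎
    where open ≡-Reasoning

  sumV-+ : ∀ (P : VSet n) (f g : Fin n → ℚ) → sumV P (λ v → f v + g v) ≡ sumV P f + sumV P g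
  sumV-+ P f g = sumV-+-pointwise {P} {P} {P} {f} {g} split
    where
    split : ∀ v → (if P v then f v + g v else 0ℚ) ≡ (if P v then f v else 0ℚ) + (if P v then g v else 0ℚ)
    split v with P v
    ... | true = refl
    ... | false = refl

  sumV-*ʳ : ∀ (P : VSet n) (f : Fin n → ℚ) c → sumV P (λ v → f v * c) ≡ sumV P f * c
  sumV-*ʳ P f c = begin
    sumV P (λ v → f v * c)                          ≡⟨ sumV≡∑ P _ ⟩
    ℚΣ.sum (λ v → if P v then f v * c else 0ℚ)      ≡⟨ ℚΣ.sum-cong-≗ pointwise ⟩
    ℚΣ.sum (λ v → (if P v then f v else 0ℚ) * c)    ≡⟨ ℚΣ.*-distribʳ-sum c (λ v → if P v then f v else 0ℚ) ⟨
    ℚΣ.sum (λ v → if P v then f v else 0ℚ) * c      ≡⟨ cong (_* c) (sumV≡∑ P f) ⟨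
    sumV P f * c                                    ∎
    where
    open ≡-Reasoning
    pointwise : ∀ v → (if P v then f v * c else 0ℚ) ≡ (if P v then f v else 0ℚ) * c
    pointwise v with P v
    ... | true = refl
    ... | false = ≡.sym (ℚₚ.*-zeroˡ c)

  sumV-∪ : ∀ (P Q : VSet n) (f : Fin n → ℚ) → (∀ v → P v ≡ true → Q v ≡ true → ⊥) →
           sumV (λ v → P v ∨ Q v) f ≡ sumV P f + sumV Q f
  sumV-∪ P Q f disjoint = sumV-+-pointwise {P} {Q} {λ v → P v ∨ Q v} {f} {f} split
    where
    split : ∀ v → (if P v ∨ Q v then f v else 0ℚ) ≡ (if P v then f v else 0ℚ) + (if Q v then f v else 0ℚ)
    split v with P v in Pv | Q v in Qv
    ... | true | true = ⊥-elim (disjoint v Pv Qv)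
    ... | true | false = ≡.sym (ℚₚ.+-identityʳ (f v))
    ... | false | _ = ≡.sym (ℚₚ.+-identityˡ _)

  sumV-1 : ∀ (P : VSet n) → sumV P (λ _ → 1ℚ) ≡ ℕ→ℚ (count P)
  sumV-1 P = begin
    sumV P (λ _ → 1ℚ)                                   ≡⟨ sumV≡∑ P (λ _ → 1ℚ) ⟩
    ℚΣ.sum (λ v → if P v then 1ℚ else 0ℚ)               ≡⟨ ℚΣ.sum-cong-≗ indicator-cast ⟩
    ℚΣ.sum (λ v → ℕ→ℚ (if P v then 1 else 0))           ≡⟨ ℕ→ℚ-sum (λ v → if P v then 1 else 0) ⟨
    ℕ→ℚ (count P)                                       ∎
    where
    open ≡-Reasoning
    indicator-cast : ∀ v → (if P v then 1ℚ else 0ℚ) ≡ ℕ→ℚ (if P v then 1 else 0)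
    indicator-cast v with P v
    ... | true = refl
    ... | false = refl

  sumV-∅ : ∀ {P : VSet n} (f : Fin n → ℚ) → (∀ v → P v ≡ false) → sumV P f ≡ 0ℚ
  sumV-∅ {P} f P≡false = begin
    sumV P f                                  ≡⟨ sumV≡∑ P f ⟩
    ℚΣ.sum (λ v → if P v then f v else 0ℚ)    ≡⟨ ℚΣ.sum-cong-≗ (λ v → cong (λ b → if b then f v else 0ℚ) (P≡false v)) ⟩
    ℚΣ.sum {n} (λ _ → 0ℚ)                     ≡⟨ ℚΣ.sum-replicate-zero n ⟩
    0ℚ                                        ∎
    where open ≡-Reasoning

  sumV-const : ∀ (P : VSet n) c → sumV P (λ _ → c) ≡ ℕ→ℚ (count P) * c
  sumV-const P c = begin
    sumV P (λ _ → c)               ≡⟨ sumV-congʳ {P} (λ _ _ → ≡.sym (ℚₚ.*-identityˡ c)) ⟩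
    sumV P (λ _ → 1ℚ * c)          ≡⟨ sumV-*ʳ P (λ _ → 1ℚ) c ⟩
    sumV P (λ _ → 1ℚ) * c          ≡⟨ cong (_* c) (sumV-1 P) ⟩
    ℕ→ℚ (count P) * c              ∎
    where open ≡-Reasoning

  sumV-partition : ∀ {p} (P : VSet n) (c : Fin n → Fin p) (f : Fin n → ℚ) →
                   ℚΣ.sum (λ i → sumV (λ v → P v ∧ ⌊ c v ≟F i ⌋) f) ≡ sumV P f
  sumV-partition {p} P c f = begin
    ℚΣ.sum (λ i → sumV (λ v → P v ∧ ⌊ c v ≟F i ⌋) f)
      ≡⟨ ℚΣ.sum-cong-≗ (λ i → sumV≡∑ (λ v → P v ∧ ⌊ c v ≟F i ⌋) f) ⟩
    ℚΣ.sum (λ i → ℚΣ.sum (λ v → if P v ∧ ⌊ c v ≟F i ⌋ then f v else 0ℚ))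
      ≡⟨ ℚΣ.∑-comm (λ i v → if P v ∧ ⌊ c v ≟F i ⌋ then f v else 0ℚ) ⟩
    ℚΣ.sum (λ v → ℚΣ.sum (λ i → if P v ∧ ⌊ c v ≟F i ⌋ then f v else 0ℚ))
      ≡⟨ ℚΣ.sum-cong-≗ one-block ⟩
    ℚΣ.sum (λ v → if P v then f v else 0ℚ)
      ≡⟨ sumV≡∑ P f ⟨
    sumV P f ∎
    where
    open ≡-Reasoning
    one-block : ∀ v → ℚΣ.sum (λ i → if P v ∧ ⌊ c v ≟F i ⌋ then f v else 0ℚ) ≡ (if P v then f v else 0ℚ)
    one-block v with P v
    ... | true = ∑-single (c v) (λ _ → f v)
    ... | false = ℚΣ.sum-replicate-zero p

  sumV-fibres : ∀ (P Q : VSet n) (φ : Fin n → Fin n) (β : Fin n → ℚ) →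
                (∀ w → P w ≡ true → Q (φ w) ≡ true) →
                sumV P (β ∘ φ) ≡ sumV Q (λ u → ℕ→ℚ (count (λ w → P w ∧ ⌊ φ w ≟F u ⌋)) * β u)
  sumV-fibres P Q φ β φ[P]⊆Q = begin
    sumV P (β ∘ φ)
      ≡⟨ sumV-partition P φ (β ∘ φ) ⟨
    ℚΣ.sum (λ u → sumV (fibre u) (β ∘ φ))
      ≡⟨ ℚΣ.sum-cong-≗ (λ u → sumV-congʳ {fibre u} (λ w w∈ → cong β (≟-true⁻ (∧-true⁻ʳ w∈)))) ⟩
    ℚΣ.sum (λ u → sumV (fibre u) (λ _ → β u))
      ≡⟨ ℚΣ.sum-cong-≗ (λ u → sumV-const (fibre u) (β u)) ⟩
    ℚΣ.sum (λ u → ℕ→ℚ (count (fibre u)) * β u)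
      ≡⟨ ℚΣ.sum-cong-≗ outside-Q ⟩
    ℚΣ.sum (λ u → if Q u then ℕ→ℚ (count (fibre u)) * β u else 0ℚ)
      ≡⟨ sumV≡∑ Q _ ⟨
    sumV Q (λ u → ℕ→ℚ (count (fibre u)) * β u) ∎
    where
    open ≡-Reasoning
    fibre : Fin n → VSet n
    fibre u w = P w ∧ ⌊ φ w ≟F u ⌋
    empty-fibre : ∀ u → Q u ≡ false → ∀ w → fibre u w ≡ false
    empty-fibre u Qu w with fibre u w in w∈
    ... | false = refl
    ... | true = ⊥-elim (true≢false (trans (≡.sym (φ[P]⊆Q w (∧-true⁻ˡ w∈)))
                                          (subst (λ x → Q x ≡ false) (≡.sym (≟-true⁻ (∧-true⁻ʳ w∈))) Qu)))
    outside-Q : ∀ u → ℕ→ℚ (count (fibre u)) * β u ≡ (if Q u then ℕ→ℚ (count (fibre u)) * β u else 0ℚ)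
    outside-Q u = ≡-if-0 (Q u) λ Qu → begin
      ℕ→ℚ (count (fibre u)) * β u        ≡⟨ cong (_* β u) (sumV-1 (fibre u)) ⟨
      sumV (fibre u) (λ _ → 1ℚ) * β u    ≡⟨ cong (_* β u) (sumV-∅ (λ _ → 1ℚ) (empty-fibre u Qu)) ⟩
      0ℚ * β u                           ≡⟨ ℚₚ.*-zeroˡ (β u) ⟩
      0ℚ                                 ∎

  sumV-guard : ∀ b (P : VSet n) (f : Fin n → ℚ) → sumV (λ v → b ∧ P v) f ≡ (if b then sumV P f else 0ℚ)
  sumV-guard true P f = refl
  sumV-guard false P f = sumV-∅ f (λ _ → refl)

  sumV-mono-⊆ : ∀ {P Q : VSet n} (f : Fin n → ℚ) → P ⊆ Q → (∀ v → 0ℚ ≤ f v) → sumV P f ≤ sumV Q f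
  sumV-mono-⊆ {P} {Q} f P⊆Q f≥0 = begin
    sumV P f                                    ≡⟨ sumV≡∑ P f ⟩
    ℚΣ.sum (λ v → if P v then f v else 0ℚ)      ≤⟨ ∑-mono-≤ pointwise ⟩
    ℚΣ.sum (λ v → if Q v then f v else 0ℚ)      ≡⟨ sumV≡∑ Q f ⟨
    sumV Q f                                    ∎
    where
    open ℚₚ.≤-Reasoning
    pointwise : ∀ v → (if P v then f v else 0ℚ) ≤ (if Q v then f v else 0ℚ)
    pointwise v with P v in Pv | Q v in Qv
    ... | true | true = ℚₚ.≤-refl
    ... | true | false = ⊥-elim (true≢false (trans (≡.sym (P⊆Q v Pv)) Qv))
    ... | false | true = f≥0 v
    ... | false | false = ℚₚ.≤-refl

  sumV-single : ∀ (v : Fin n) (f : Fin n → ℚ) → sumV (λ u → ⌊ v ≟F u ⌋) f ≡ f v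
  sumV-single v f = trans (sumV≡∑ _ f) (∑-single v f)

  count-∪ : ∀ (P Q : VSet n) → (∀ v → P v ≡ true → Q v ≡ true → ⊥) →
            ℕ→ℚ (count (λ v → P v ∨ Q v)) ≡ ℕ→ℚ (count P) + ℕ→ℚ (count Q)
  count-∪ P Q disjoint = begin
    ℕ→ℚ (count (λ v → P v ∨ Q v))              ≡⟨ sumV-1 (λ v → P v ∨ Q v) ⟨
    sumV (λ v → P v ∨ Q v) (λ _ → 1ℚ)          ≡⟨ sumV-∪ P Q (λ _ → 1ℚ) disjoint ⟩
    sumV P (λ _ → 1ℚ) + sumV Q (λ _ → 1ℚ)      ≡⟨ cong₂ _+_ (sumV-1 P) (sumV-1 Q) ⟩
    ℕ→ℚ (count P) + ℕ→ℚ (count Q)              ∎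
    where open ≡-Reasoning

  count-single : ∀ (v : Fin n) → ℕ→ℚ (count (λ u → ⌊ v ≟F u ⌋)) ≡ 1ℚ
  count-single v = trans (≡.sym (sumV-1 (λ u → ⌊ v ≟F u ⌋))) (sumV-single v (λ _ → 1ℚ))

  count-insert : ∀ {P Q : VSet n} {v} → P ⊆ Q → Q v ≡ true → P v ≡ false →
                 1ℚ + ℕ→ℚ (count P) ≤ ℕ→ℚ (count Q)
  count-insert {P} {Q} {v} P⊆Q Qv Pv = begin
    1ℚ + ℕ→ℚ (count P)                                 ≡⟨ cong (_+ ℕ→ℚ (count P)) (count-single v) ⟨
    ℕ→ℚ (count (λ u → ⌊ v ≟F u ⌋)) + ℕ→ℚ (count P)    ≡⟨ count-∪ (λ u → ⌊ v ≟F u ⌋) P v∉P ⟨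
    ℕ→ℚ (count (λ u → ⌊ v ≟F u ⌋ ∨ P u))              ≡⟨ sumV-1 (λ u → ⌊ v ≟F u ⌋ ∨ P u) ⟨
    sumV (λ u → ⌊ v ≟F u ⌋ ∨ P u) (λ _ → 1ℚ)          ≤⟨ sumV-mono-⊆ (λ _ → 1ℚ) v∪P⊆Q (λ _ → 0≤1) ⟩
    sumV Q (λ _ → 1ℚ)                                   ≡⟨ sumV-1 Q ⟩
    ℕ→ℚ (count Q)                                       ∎
    where
    open ℚₚ.≤-Reasoning
    v∉P : ∀ u → ⌊ v ≟F u ⌋ ≡ true → P u ≡ true → ⊥
    v∉P u v≡u Pu = true≢false (trans (≡.sym Pu) (subst (λ x → P x ≡ false) (≟-true⁻ v≡u) Pv))
    v∪P⊆Q : (λ u → ⌊ v ≟F u ⌋ ∨ P u) ⊆ Q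
    v∪P⊆Q = ∪-⊆ {P = λ u → ⌊ v ≟F u ⌋} {P} {Q} (single-⊆ Qv) P⊆Q

  count-pos : ∀ {P : VSet n} {v} → P v ≡ true → 0ℚ ℚ.< ℕ→ℚ (count P)
  count-pos {P} {v} Pv = ℚₚ.<-≤-trans 0<1+∅ (count-insert {∅} {P} (λ _ ()) Pv refl)
    where
    0<1+∅ : 0ℚ ℚ.< 1ℚ + ℕ→ℚ (count {n} ∅)
    0<1+∅ = ℚₚ.<-≤-trans 0<1 (p≤p+q 1ℚ (ℕ→ℚ-nonNeg (count {n} ∅)))

  sumV-split : ∀ {P Q : VSet n} (f : Fin n → ℚ) → Q ⊆ P →
               sumV P f ≡ sumV (λ v → P v ∧ not (Q v)) f + sumV Q f
  sumV-split {P} {Q} f Q⊆P = sumV-+-pointwise {λ v → P v ∧ not (Q v)} {Q} {P} {f} {f} split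
    where
    split : ∀ v → (if P v then f v else 0ℚ)
                ≡ (if P v ∧ not (Q v) then f v else 0ℚ) + (if Q v then f v else 0ℚ)
    split v with P v in Pv | Q v in Qv
    ... | true | true = ≡.sym (ℚₚ.+-identityˡ (f v))
    ... | true | false = ≡.sym (ℚₚ.+-identityʳ (f v))
    ... | false | true = ⊥-elim (true≢false (trans (≡.sym (Q⊆P v Qv)) Pv))
    ... | false | false = ≡.sym (ℚₚ.+-identityˡ 0ℚ)

averaging : ∀ {n} (P : VSet n) (r : Fin n) (a b : Fin n → ℚ) →
  0ℚ ≤ b r → (∀ u → P u ≡ true → b u ≤ b r) →
  (∀ u → P u ≡ true → u ≢ r → 0ℚ ℚ.< a u × a u ≤ b u) →
  sumV P a ≤ sumV P b →
  sumV P (λ u → a u * inv (b u)) ≤ ℕ→ℚ (count P)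
averaging P r a b 0≤br b≤br a≤b Σa≤Σb = +-cancelʳ-≤ (begin
  sumV P (λ u → a u * inv (b u)) + sumV P b * c
    ≡⟨ cong (sumV P (λ u → a u * inv (b u)) +_) (sumV-*ʳ P b c) ⟨
  sumV P (λ u → a u * inv (b u)) + sumV P (λ u → b u * c)
    ≡⟨ sumV-+ P (λ u → a u * inv (b u)) (λ u → b u * c) ⟨
  sumV P (λ u → a u * inv (b u) + b u * c)
    ≤⟨ sumV-mono pointwise ⟩
  sumV P (λ u → 1ℚ + a u * c)
    ≡⟨ sumV-+ P (λ _ → 1ℚ) (λ u → a u * c) ⟩
  sumV P (λ _ → 1ℚ) + sumV P (λ u → a u * c)
    ≡⟨ cong₂ _+_ (sumV-1 P) (sumV-*ʳ P a c) ⟩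
  ℕ→ℚ (count P) + sumV P a * c
    ≤⟨ ℚₚ.+-monoʳ-≤ (ℕ→ℚ (count P)) (ℚₚ.*-monoʳ-≤-nonNeg c {{ℚ.nonNegative (inv-nonNeg 0≤br)}} Σa≤Σb) ⟩
  ℕ→ℚ (count P) + sumV P b * c ∎)
  where
  open ℚₚ.≤-Reasoning
  c = inv (b r)
  pointwise : ∀ u → P u ≡ true → a u * inv (b u) + b u * c ≤ 1ℚ + a u * c
  pointwise u Pu with u ≟F r
  ... | yes refl = exchange-root (a r) (b r)
  ... | no u≢r = exchange (proj₁ (a≤b u Pu u≢r)) (proj₂ (a≤b u Pu u≢r)) (b≤br u Pu)

private
  indicator : Bool → ℚ
  indicator b = if b then 1ℚ else 0ℚ

  indicator-nonNeg : ∀ b → 0ℚ ≤ indicator b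
  indicator-nonNeg true = 0≤1
  indicator-nonNeg false = ℚₚ.≤-refl

  indicator-≤-+ : ∀ a b c → (a ≡ true → b ≡ true ⊎ c ≡ true) → indicator a ≤ indicator b + indicator c
  indicator-≤-+ false b c _ = ℚₚ.≤-trans (indicator-nonNeg b) (p≤p+q (indicator b) (indicator-nonNeg c))
  indicator-≤-+ true b c b∨c with b∨c refl
  ... | inj₁ refl = p≤p+q 1ℚ (indicator-nonNeg c)
  ... | inj₂ refl = subst (_≤ indicator b + 1ℚ) (ℚₚ.+-identityˡ 1ℚ) (ℚₚ.+-monoˡ-≤ 1ℚ (indicator-nonNeg b))

  indicator-disjoint : ∀ z x y → (x ≡ true → y ≡ true → ⊥) → indicator (z ∧ x) + indicator (z ∧ y) ≤ indicator z
  indicator-disjoint false x y _ = ℚₚ.≤-reflexive (ℚₚ.+-identityˡ 0ℚ)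
  indicator-disjoint true false false _ = ℚₚ.≤-trans (ℚₚ.≤-reflexive (ℚₚ.+-identityˡ 0ℚ)) 0≤1
  indicator-disjoint true true false _ = ℚₚ.≤-reflexive (ℚₚ.+-identityʳ 1ℚ)
  indicator-disjoint true false true _ = ℚₚ.≤-reflexive (ℚₚ.+-identityˡ 1ℚ)
  indicator-disjoint true true true x∧y = ⊥-elim (x∧y refl refl)

unordered≤ordered : ∀ {n} (E A : Fin n → Fin n → Bool) →
  (∀ u v → E u v ≡ true → A u v ≡ true ⊎ A v u ≡ true) →
  ℚΣ.sum (λ u → sumV (λ v → ⌊ toℕ u ℕ.<? toℕ v ⌋ ∧ E u v) (λ _ → 1ℚ)) ≤ ℚΣ.sum (λ u → sumV (A u) (λ _ → 1ℚ))
unordered≤ordered {n} E A E⇒A = begin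
  ℚΣ.sum (λ u → sumV (λ v → u ≺ v ∧ E u v) (λ _ → 1ℚ))
    ≡⟨ ℚΣ.sum-cong-≗ (λ u → sumV≡∑ (λ v → u ≺ v ∧ E u v) (λ _ → 1ℚ)) ⟩
  Σ² (λ u v → indicator (u ≺ v ∧ E u v))
    ≤⟨ ∑-mono-≤ (λ u → ∑-mono-≤ (λ v → indicator-≤-+ (u ≺ v ∧ E u v) (A u v ∧ u ≺ v) (A v u ∧ u ≺ v) (orient u v))) ⟩
  Σ² (λ u v → indicator (A u v ∧ u ≺ v) + indicator (A v u ∧ u ≺ v))
    ≡⟨ ℚΣ.sum-cong-≗ (λ u → ℚΣ.∑-distrib-+ (λ v → indicator (A u v ∧ u ≺ v)) (λ v → indicator (A v u ∧ u ≺ v))) ⟩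
  ℚΣ.sum (λ u → ℚΣ.sum (λ v → indicator (A u v ∧ u ≺ v)) + ℚΣ.sum (λ v → indicator (A v u ∧ u ≺ v)))
    ≡⟨ ℚΣ.∑-distrib-+ (λ u → ℚΣ.sum (λ v → indicator (A u v ∧ u ≺ v))) (λ u → ℚΣ.sum (λ v → indicator (A v u ∧ u ≺ v))) ⟩
  Σ² (λ u v → indicator (A u v ∧ u ≺ v)) + Σ² (λ u v → indicator (A v u ∧ u ≺ v))
    ≡⟨ cong (Σ² (λ u v → indicator (A u v ∧ u ≺ v)) +_) (ℚΣ.∑-comm (λ u v → indicator (A v u ∧ u ≺ v))) ⟩
  Σ² (λ u v → indicator (A u v ∧ u ≺ v)) + Σ² (λ u v → indicator (A u v ∧ v ≺ u))
    ≡⟨ ℚΣ.∑-distrib-+ (λ u → ℚΣ.sum (λ v → indicator (A u v ∧ u ≺ v))) (λ u → ℚΣ.sum (λ v → indicator (A u v ∧ v ≺ u))) ⟨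
  ℚΣ.sum (λ u → ℚΣ.sum (λ v → indicator (A u v ∧ u ≺ v)) + ℚΣ.sum (λ v → indicator (A u v ∧ v ≺ u)))
    ≡⟨ ℚΣ.sum-cong-≗ (λ u → ℚΣ.∑-distrib-+ (λ v → indicator (A u v ∧ u ≺ v)) (λ v → indicator (A u v ∧ v ≺ u))) ⟨
  Σ² (λ u v → indicator (A u v ∧ u ≺ v) + indicator (A u v ∧ v ≺ u))
    ≤⟨ ∑-mono-≤ (λ u → ∑-mono-≤ (λ v → indicator-disjoint (A u v) (u ≺ v) (v ≺ u) (≺-asym u v))) ⟩
  Σ² (λ u v → indicator (A u v))
    ≡⟨ ℚΣ.sum-cong-≗ (λ u → sumV≡∑ (A u) (λ _ → 1ℚ)) ⟨
  ℚΣ.sum (λ u → sumV (A u) (λ _ → 1ℚ)) ∎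
  where
  open ℚₚ.≤-Reasoning
  _≺_ : Fin n → Fin n → Bool
  u ≺ v = ⌊ toℕ u ℕ.<? toℕ v ⌋
  Σ² : (Fin n → Fin n → ℚ) → ℚ
  Σ² h = ℚΣ.sum (λ u → ℚΣ.sum (h u))
  ≺-true⁻ : ∀ {u v} → u ≺ v ≡ true → toℕ u < toℕ v
  ≺-true⁻ {u} {v} _ with toℕ u ℕ.<? toℕ v
  ... | yes u<v = u<v
  ≺-asym : ∀ u v → u ≺ v ≡ true → v ≺ u ≡ true → ⊥
  ≺-asym u v u≺v v≺u = ℕₚ.<-asym (≺-true⁻ u≺v) (≺-true⁻ v≺u)
  orient : ∀ u v → u ≺ v ∧ E u v ≡ true → A u v ∧ u ≺ v ≡ true ⊎ A v u ∧ u ≺ v ≡ true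
  orient u v uv∈ with E⇒A u v (∧-true⁻ʳ {u ≺ v} uv∈)
  ... | inj₁ Auv = inj₁ (∧-true⁺ Auv (∧-true⁻ˡ uv∈))
  ... | inj₂ Avu = inj₂ (∧-true⁺ Avu (∧-true⁻ˡ uv∈))

-- Extremal vertices and choice

module _ {n : ℕ} (P : VSet n) (f : Fin n → ℕ) {v₀ : Fin n} (Pv₀ : P v₀ ≡ true) where

  private
    candidates : List (Fin n)
    candidates = filter (λ v → P v ≟B true) (allFin n)

    P-candidates : All (λ v → P v ≡ true) candidates
    P-candidates = all-filter (λ v → P v ≟B true) (allFin n)

    ∈-candidates : ∀ {u} → P u ≡ true → u ∈ candidates
    ∈-candidates Pu = ∈-filter⁺ (λ v → P v ≟B true) (∈-allFin _) Pu

  minimiser : Σ (Fin n) λ v → P v ≡ true × (∀ u → P u ≡ true → f v ℕ.≤ f u)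
  minimiser = v , Extrema.argmin-all f Pv₀ P-candidates ,
              λ u Pu → All.lookup (Extrema.f[argmin]≤f[xs] v₀ candidates) (∈-candidates Pu)
    where v = Extrema.argmin f v₀ candidates

  maximiser : Σ (Fin n) λ v → P v ≡ true × (∀ u → P u ≡ true → f u ℕ.≤ f v)
  maximiser = v , Extrema.argmax-all f Pv₀ P-candidates ,
              λ u Pu → All.lookup (Extrema.f[xs]≤f[argmax] v₀ candidates) (∈-candidates Pu)
    where v = Extrema.argmax f v₀ candidates

-- Abstract, so that functions obtained by choice never unfold into their witnesses during type checking.
abstract
  choose : ∀ {n} {A : Set} {Q : Fin n → A → Set} (P : VSet n) → (Fin n → A) →
           (∀ v → P v ≡ true → Σ A (Q v)) → Σ (Fin n → A) λ f → ∀ v → P v ≡ true → Q v (f v)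
  choose {A = A} {Q} P default witness = (λ v → pick v (P v) refl) , (λ v Pv → pick-spec v (P v) refl Pv)
    where
    pick : ∀ v b → P v ≡ b → A
    pick v true Pv = proj₁ (witness v Pv)
    pick v false _ = default v
    pick-spec : ∀ v b (Pv≡b : P v ≡ b) → b ≡ true → Q v (pick v b Pv≡b)
    pick-spec v true Pv _ = proj₂ (witness v Pv)

least : ∀ (P : ℕ → Bool) {m} → P m ≡ true → Σ ℕ λ k → P k ≡ true × (∀ j → P j ≡ true → k ℕ.≤ j)
least P {ℕ.zero} P0 = 0 , P0 , λ _ _ → z≤n
least P {ℕ.suc m} Pm with P 0 in P0
... | true = 0 , P0 , λ _ _ → z≤n
... | false with least (P ∘ ℕ.suc) Pm
... | k , Pk , k-least = ℕ.suc k , Pk , λ where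
  ℕ.zero P0′ → ⊥-elim (true≢false (trans (≡.sym P0′) P0))
  (ℕ.suc j) Pj → s≤s (k-least j Pj)

-- Independent sets, neighbourhoods, induced subgraphs

module _ {n : ℕ} (G : Graph n) where

  independent-∪ : ∀ {I J : VSet n} → Independent G I → Independent G J →
                  (∀ u v → I u ≡ true → J v ≡ true → adj G u v ≡ false) →
                  Independent G (λ v → I v ∨ J v)
  independent-∪ {I} {J} I-indep J-indep no-edge u v u∈ v∈ with ∨-true⁻ {I u} u∈ | ∨-true⁻ {I v} v∈
  ... | inj₁ Iu | inj₁ Iv = I-indep u v Iu Iv
  ... | inj₁ Iu | inj₂ Jv = no-edge u v Iu Jv
  ... | inj₂ Ju | inj₁ Iv = trans (sym G u v) (no-edge v u Iv Ju)
  ... | inj₂ Ju | inj₂ Jv = J-indep u v Ju Jv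

  independent-single : ∀ v → Independent G (λ u → ⌊ v ≟F u ⌋)
  independent-single v a b a∈ b∈ rewrite ≡.sym (≟-true⁻ a∈) | ≡.sym (≟-true⁻ b∈) = irrefl G v

  N-true⁻ : ∀ {X : VSet n} {v} → N G X v ≡ true → Σ (Fin n) λ u → X u ≡ true × adj G u v ≡ true
  N-true⁻ {X} v∈ with anyV-true⁻ v∈
  ... | u , u∈ = u , ∧-true⁻ˡ u∈ , ∧-true⁻ʳ {X u} u∈

  N-true⁺ : ∀ {X : VSet n} {u v} → X u ≡ true → adj G u v ≡ true → N G X v ≡ true
  N-true⁺ {X} {u} {v} Xu uv = anyV-true⁺ {P = λ w → X w ∧ adj G w v} u (∧-true⁺ Xu uv)

  closed-nbhd-size : ∀ (H : Subgraph G) v →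
                     ℕ→ℚ (count (λ u → ⌊ v ≟F u ⌋ ∨ F H v u)) ≡ 1ℚ + ℕ→ℚ (degH H v)
  closed-nbhd-size H v = trans (count-∪ (λ u → ⌊ v ≟F u ⌋) (F H v) v∉F) (cong (_+ ℕ→ℚ (degH H v)) (count-single v))
    where
    v∉F : ∀ u → ⌊ v ≟F u ⌋ ≡ true → F H v u ≡ true → ⊥
    v∉F u v≡u vu∈F = true≢false (trans (≡.sym (F⊆E H v u vu∈F))
                                       (subst (λ x → adj G v x ≡ false) (≟-true⁻ v≡u) (irrefl G v)))

  induced : VSet n → Subgraph G
  induced X = record
    { W = X
    ; F = λ a b → X a ∧ X b ∧ adj G a b
    ; F-sym = edges-sym
    ; F⊆E = λ a b ab∈ → ∧-true⁻ʳ {X b} (∧-true⁻ʳ {X a} ab∈)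
    ; F⊆W = λ a b ab∈ → ∧-true⁻ˡ ab∈
    }
    where
    edges-sym : ∀ a b → (X a ∧ X b ∧ adj G a b) ≡ (X b ∧ X a ∧ adj G b a)
    edges-sym a b with X a | X b
    ... | true | true = sym G a b
    ... | true | false = refl
    ... | false | true = refl
    ... | false | false = refl

module CaroWei {n : ℕ} (G : Graph n) (ζ : Fin n → ℕ) (ζ-spec : ∀ v → IsZeta G v (ζ v)) where

  weight : Fin n → ℚ
  weight v = inv (ℕ→ℚ (ζ v) + 1ℚ)

  HasHeavyIndependentSubset : VSet n → Set
  HasHeavyIndependentSubset X =
    Σ (VSet n) λ I → Independent G I × I ⊆ X × sumV X weight ≤ ℕ→ℚ (count I)

  private
    greedy-step : ∀ X → (∀ {Y} → count Y < count X → HasHeavyIndependentSubset Y) →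
      (Σ (Fin n) λ v → X v ≡ true × (∀ u → X u ≡ true → degH (induced G X) v ℕ.≤ degH (induced G X) u)) →
      HasHeavyIndependentSubset X
    greedy-step X rec (v , Xv , v-min) = I , I-indep , I⊆X , weight-bound
      where
      H = induced G X
      d = degH H v
      c = inv (ℕ→ℚ d + 1ℚ)

      N[v] X′ : VSet n
      N[v] u = ⌊ v ≟F u ⌋ ∨ F H v u
      X′ u = X u ∧ not (N[v] u)

      N[v]⊆X : N[v] ⊆ X
      N[v]⊆X = ∪-⊆ {P = λ u → ⌊ v ≟F u ⌋} {F H v} {X} (single-⊆ Xv) (λ u vu∈F → ∧-true⁻ˡ (∧-true⁻ʳ {X v} vu∈F))

      X′⊆X : X′ ⊆ X
      X′⊆X u = ∧-true⁻ˡ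

      v∉X′ : X′ v ≡ false
      v∉X′ = trans (cong (λ b → X v ∧ not b) (∨-true⁺ˡ (F H v v) (≟-refl v))) (Boolₚ.∧-zeroʳ (X v))

      X′-non-adjacent : ∀ b → X′ b ≡ true → adj G v b ≡ false
      X′-non-adjacent b X′b = begin
        adj G v b   ≡⟨ cong₂ (λ x y → x ∧ y ∧ adj G v b) Xv (∧-true⁻ˡ X′b) ⟨
        F H v b     ≡⟨ Boolₚ.∨-conicalʳ ⌊ v ≟F b ⌋ (F H v b) (not-true⁻ (∧-true⁻ʳ {X b} X′b)) ⟩
        false       ∎
        where open ≡-Reasoning

      ζ≥d : ∀ u → X u ≡ true → d ℕ.≤ ζ u
      ζ≥d u Xu = proj₂ (ζ-spec u) H d Xu ((v , Xv , refl) , v-min)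

      smaller : HasHeavyIndependentSubset X′
      smaller = rec {X′} (ℕ→ℚ-cancel-< {count X′} {count X} (count-insert {P = X′} {Q = X} {v = v} X′⊆X Xv v∉X′))

      I′ : VSet n
      I′ = proj₁ smaller

      I′⊆X′ : I′ ⊆ X′
      I′⊆X′ = proj₁ (proj₂ (proj₂ smaller))

      I : VSet n
      I u = ⌊ v ≟F u ⌋ ∨ I′ u

      v∉I′ : ∀ u → ⌊ v ≟F u ⌋ ≡ true → I′ u ≡ true → ⊥
      v∉I′ u v≡u I′u = true≢false (trans (≡.sym (I′⊆X′ u I′u)) (subst (λ x → X′ x ≡ false) (≟-true⁻ v≡u) v∉X′))

      I-indep : Independent G I
      I-indep = independent-∪ G (independent-single G v) (proj₁ (proj₂ smaller))
        λ a b v≡a I′b → subst (λ x → adj G x b ≡ false) (≟-true⁻ v≡a) (X′-non-adjacent b (I′⊆X′ b I′b))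

      I⊆X : I ⊆ X
      I⊆X = ∪-⊆ {P = λ u → ⌊ v ≟F u ⌋} {I′} {X} (single-⊆ Xv) (λ u I′u → X′⊆X u (I′⊆X′ u I′u))

      weight≤c : ∀ u → N[v] u ≡ true → weight u ≤ c
      weight≤c u u∈ = inv-antitone (ℕ→ℚ+1-pos d) (ℚₚ.+-monoˡ-≤ 1ℚ (ℕ→ℚ-mono-≤ (ζ≥d u (N[v]⊆X u u∈))))

      N[v]-total : sumV N[v] (λ _ → c) ≡ 1ℚ
      N[v]-total = begin
        sumV N[v] (λ _ → c)       ≡⟨ sumV-const N[v] c ⟩
        ℕ→ℚ (count N[v]) * c      ≡⟨ cong (_* c) (closed-nbhd-size G H v) ⟩
        (1ℚ + ℕ→ℚ d) * c          ≡⟨ cong (_* c) (ℚₚ.+-comm 1ℚ (ℕ→ℚ d)) ⟩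
        (ℕ→ℚ d + 1ℚ) * c          ≡⟨ *-inv (λ d+1≡0 → ℚₚ.<-irrefl (≡.sym d+1≡0) (ℕ→ℚ+1-pos d)) ⟩
        1ℚ                        ∎
        where open ≡-Reasoning

      count-I : ℕ→ℚ (count I) ≡ ℕ→ℚ (count I′) + 1ℚ
      count-I = begin
        ℕ→ℚ (count I)                                     ≡⟨ count-∪ (λ u → ⌊ v ≟F u ⌋) I′ v∉I′ ⟩
        ℕ→ℚ (count (λ u → ⌊ v ≟F u ⌋)) + ℕ→ℚ (count I′)   ≡⟨ cong (_+ ℕ→ℚ (count I′)) (count-single v) ⟩
        1ℚ + ℕ→ℚ (count I′)                               ≡⟨ ℚₚ.+-comm 1ℚ (ℕ→ℚ (count I′)) ⟩
        ℕ→ℚ (count I′) + 1ℚ                               ∎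
        where open ≡-Reasoning

      weight-bound : sumV X weight ≤ ℕ→ℚ (count I)
      weight-bound = begin
        sumV X weight                          ≡⟨ sumV-split weight N[v]⊆X ⟩
        sumV X′ weight + sumV N[v] weight      ≤⟨ ℚₚ.+-mono-≤ (proj₂ (proj₂ (proj₂ smaller))) (sumV-mono weight≤c) ⟩
        ℕ→ℚ (count I′) + sumV N[v] (λ _ → c)   ≡⟨ cong (ℕ→ℚ (count I′) +_) N[v]-total ⟩
        ℕ→ℚ (count I′) + 1ℚ                    ≡⟨ count-I ⟨
        ℕ→ℚ (count I)                          ∎
        where open ℚₚ.≤-Reasoning

  heavy-independent-subset : ∀ X → HasHeavyIndependentSubset X
  heavy-independent-subset = WF.All.wfRec (On.wellFounded count <-wellFounded) _ HasHeavyIndependentSubset recurse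
    where
    recurse : ∀ X → (∀ {Y} → count Y < count X → HasHeavyIndependentSubset Y) → HasHeavyIndependentSubset X
    recurse X rec = [ empty , inhabited ]′ (empty-or-inhabited X)
      where
      empty : (∀ v → X v ≡ false) → HasHeavyIndependentSubset X
      empty X-empty = ∅ , (λ _ _ ()) , (λ _ ()) ,
                      ℚₚ.≤-trans (ℚₚ.≤-reflexive (sumV-∅ weight X-empty)) (ℕ→ℚ-nonNeg (count {n} ∅))
      inhabited : Σ (Fin n) (λ v → X v ≡ true) → HasHeavyIndependentSubset X
      inhabited (v₀ , Xv₀) = greedy-step X rec (minimiser X (degH (induced G X)) Xv₀)

-- One component of B

module Component {n : ℕ} (G : Graph n) (ζ : Fin n → ℕ) (S : VSet n) (S-max : MaximalIndepInCheap G ζ S)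
                 {p : ℕ} (comp : Fin n → Fin p) (labelling : IsComponentLabelling G S p comp) (i : Fin p) where

  Sᵢ Tᵢ : VSet n
  Sᵢ v = S v ∧ VB G S comp i v
  Tᵢ = N G Sᵢ

  S-indep : Independent G S
  S-indep = proj₁ (proj₂ S-max)

  S-cheap : ∀ v → S v ≡ true → Cheap G ζ v
  S-cheap = proj₁ S-max

  N[S]-disjoint : ∀ w → N G S w ≡ true → S w ≡ false
  N[S]-disjoint w w∈ with N-true⁻ G w∈
  ... | u , Su , uw = ¬-not (λ Sw → true≢false (trans (≡.sym uw) (S-indep u w Su Sw)))

  edgeB⇒S-adj : ∀ u v → edgeB G S u v ≡ true →
                S u ≡ true × adj G u v ≡ true ⊎ S v ≡ true × adj G v u ≡ true
  edgeB⇒S-adj u v uv∈ with ∨-true⁻ {S u ∧ N G S v} (∧-true⁻ʳ {adj G u v} uv∈)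
  ... | inj₁ u∈S = inj₁ (∧-true⁻ˡ u∈S , ∧-true⁻ˡ uv∈)
  ... | inj₂ v∈S = inj₂ (∧-true⁻ˡ v∈S , trans (sym G v u) (∧-true⁻ˡ uv∈))

  edgeB⇒inB : ∀ u v → edgeB G S u v ≡ true → inB G S u ≡ true × inB G S v ≡ true
  edgeB⇒inB u v uv∈ with edgeB⇒S-adj u v uv∈
  ... | inj₁ (Su , uv) = ∨-true⁺ˡ (N G S u) Su , ∨-true⁺ʳ (S v) (N-true⁺ G Su uv)
  ... | inj₂ (Sv , vu) = ∨-true⁺ʳ (S u) (N-true⁺ G Sv vu) , ∨-true⁺ˡ (N G S v) Sv

  edgeB-S-side : ∀ y w → edgeB G S y w ≡ true → S w ≡ false → S y ≡ true
  edgeB-S-side y w yw∈ Sw≡false with edgeB⇒S-adj y w yw∈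
  ... | inj₁ (Sy , _) = Sy
  ... | inj₂ (Sw , _) = ⊥-elim (true≢false (trans (≡.sym Sw) Sw≡false))

  adj⇒edgeB : ∀ {u w} → S u ≡ true → adj G u w ≡ true → edgeB G S u w ≡ true
  adj⇒edgeB {u} {w} Su uw = ∧-true⁺ uw (∨-true⁺ˡ (S w ∧ N G S u) (∧-true⁺ Su (N-true⁺ G Su uw)))

  edgeB⇒same-comp : ∀ a b → edgeB G S a b ≡ true → comp a ≡ comp b
  edgeB⇒same-comp a b ab∈ = proj₂ (proj₁ labelling a b (proj₁ inB-ab) (proj₂ inB-ab)) (step ab∈ here)
    where inB-ab = edgeB⇒inB a b ab∈

  VB-i : ∀ {v} → inB G S v ≡ true → comp v ≡ i → VB G S comp i v ≡ true
  VB-i {v} v∈B refl = ∧-true⁺ v∈B (≟-refl (comp v))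

  VB-comp : ∀ {v} → VB G S comp i v ≡ true → comp v ≡ i
  VB-comp {v} v∈ = ≟-true⁻ (∧-true⁻ʳ {inB G S v} v∈)

  edgeB-VBʳ : ∀ a b → edgeB G S a b ≡ true → VB G S comp i a ≡ true → VB G S comp i b ≡ true
  edgeB-VBʳ a b ab∈ a∈ = VB-i (proj₂ (edgeB⇒inB a b ab∈)) (trans (≡.sym (edgeB⇒same-comp a b ab∈)) (VB-comp a∈))

  edgeB-VBˡ : ∀ a b → edgeB G S a b ≡ true → VB G S comp i b ≡ true → VB G S comp i a ≡ true
  edgeB-VBˡ a b ab∈ b∈ = VB-i (proj₁ (edgeB⇒inB a b ab∈)) (trans (edgeB⇒same-comp a b ab∈) (VB-comp b∈))

  Tᵢ⇒VB : ∀ w → Tᵢ w ≡ true → VB G S comp i w ≡ true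
  Tᵢ⇒VB w w∈ with N-true⁻ G w∈
  ... | u , Sᵢu , uw = edgeB-VBʳ u w (adj⇒edgeB (∧-true⁻ˡ Sᵢu) uw) (∧-true⁻ʳ {S u} Sᵢu)

  Tᵢ⇒N[S] : ∀ w → Tᵢ w ≡ true → N G S w ≡ true
  Tᵢ⇒N[S] w w∈ with N-true⁻ G w∈
  ... | u , Sᵢu , uw = N-true⁺ G (∧-true⁻ˡ Sᵢu) uw

  Tᵢ∩Sᵢ=∅ : ∀ v → Tᵢ v ≡ true → Sᵢ v ≡ true → ⊥
  Tᵢ∩Sᵢ=∅ v Tᵢv Sᵢv = true≢false (trans (≡.sym (∧-true⁻ˡ Sᵢv)) (N[S]-disjoint v (Tᵢ⇒N[S] v Tᵢv)))

  count-Sᵢ : count Sᵢ ≡ sB G S comp i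
  count-Sᵢ = count-cong (λ v → Boolₚ.∧-comm (S v) (VB G S comp i v))

  count-Tᵢ : count Tᵢ ≡ tB G S comp i
  count-Tᵢ = count-cong (λ w → ≡-from-⇔ (λ w∈ → ∧-true⁺ (Tᵢ⇒VB w w∈) (Tᵢ⇒N[S] w w∈)) (from w))
    where
    from : ∀ w → VB G S comp i w ∧ N G S w ≡ true → Tᵢ w ≡ true
    from w w∈ with N-true⁻ G (∧-true⁻ʳ {VB G S comp i w} w∈)
    ... | u , Su , uw = N-true⁺ G (∧-true⁺ Su (edgeB-VBˡ u w (adj⇒edgeB Su uw) (∧-true⁻ˡ w∈))) uw

  Sᵢ-nonempty : Σ (Fin n) λ u → Sᵢ u ≡ true
  Sᵢ-nonempty with proj₂ labelling i
  ... | u , u∈B , refl with ∨-true⁻ {S u} u∈B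
  ...   | inj₁ Su = u , ∧-true⁺ Su (VB-i u∈B refl)
  ...   | inj₂ u∈N[S] with N-true⁻ G u∈N[S]
  ...     | s , Ss , su = s , ∧-true⁺ Ss (edgeB-VBˡ s u (adj⇒edgeB Ss su) (VB-i u∈B refl))

  module BFS (r : Fin n) (Sᵢr : Sᵢ r ≡ true) where

    reach : ℕ → VSet n
    reach ℕ.zero v = ⌊ r ≟F v ⌋
    reach (ℕ.suc k) v = reach k v ∨ anyV (λ y → reach k y ∧ edgeB G S y v)

    walk⇒reach : ∀ {a b} → Walk G S a b → ∀ {k} → reach k a ≡ true → Σ ℕ λ m → reach m b ≡ true
    walk⇒reach here {k} a∈ = k , a∈
    walk⇒reach (step {u} {v} uv∈ rest) {k} u∈ =
      walk⇒reach rest {ℕ.suc k} (∨-true⁺ʳ (reach k v) (anyV-true⁺ {P = λ y → reach k y ∧ edgeB G S y v} u (∧-true⁺ u∈ uv∈)))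

    VB⇒reach : ∀ v → VB G S comp i v ≡ true → Σ ℕ λ k → reach k v ≡ true
    VB⇒reach v v∈ = walk⇒reach (proj₁ (proj₁ labelling r v (∧-true⁻ˡ r∈) (∧-true⁻ˡ v∈)) same-comp) {0} (≟-refl r)
      where
      r∈ = ∧-true⁻ʳ {S r} Sᵢr
      same-comp = trans (VB-comp r∈) (≡.sym (VB-comp v∈))

    IsDist : Fin n → ℕ → Set
    IsDist v k = reach k v ≡ true × (∀ j → reach j v ≡ true → k ℕ.≤ j)

    private
      dist-choice : Σ (Fin n → ℕ) λ dist → ∀ v → VB G S comp i v ≡ true → IsDist v (dist v)
      dist-choice = choose {Q = IsDist} (VB G S comp i) (λ _ → 0) (λ v v∈ → least (λ k → reach k v) {proj₁ (VB⇒reach v v∈)} (proj₂ (VB⇒reach v v∈)))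

    dist : Fin n → ℕ
    dist = proj₁ dist-choice

    dist-spec : ∀ v → VB G S comp i v ≡ true → IsDist v (dist v)
    dist-spec = proj₂ dist-choice

    parent : ∀ v → VB G S comp i v ≡ true → v ≢ r → Σ (Fin n) λ y → edgeB G S y v ≡ true × dist y < dist v
    parent v v∈ v≢r with dist v | dist-spec v v∈
    ... | ℕ.zero | r≡v , _ = ⊥-elim (v≢r (≡.sym (≟-true⁻ r≡v)))
    ... | ℕ.suc k | v∈reach , v-least with ∨-true⁻ {reach k v} v∈reach
    ...   | inj₁ v∈earlier = ⊥-elim (ℕₚ.1+n≰n (v-least k v∈earlier))
    ...   | inj₂ via-edge with anyV-true⁻ via-edge
    ...     | y , y∈ = y , ∧-true⁻ʳ {reach k y} y∈ ,
                       s≤s (proj₂ (dist-spec y (edgeB-VBˡ y v (∧-true⁻ʳ {reach k y} y∈) v∈)) k (∧-true⁻ˡ y∈))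

    Tᵢ∌r : ∀ w → Tᵢ w ≡ true → w ≢ r
    Tᵢ∌r w w∈ refl = true≢false (trans (≡.sym (∧-true⁻ˡ Sᵢr)) (N[S]-disjoint w (Tᵢ⇒N[S] w w∈)))

    private
      φ-choice : Σ (Fin n → Fin n) λ φ → ∀ w → Tᵢ w ≡ true → edgeB G S (φ w) w ≡ true × dist (φ w) < dist w
      φ-choice = choose Tᵢ (λ w → w) (λ w w∈ → parent w (Tᵢ⇒VB w w∈) (Tᵢ∌r w w∈))

    φ : Fin n → Fin n
    φ = proj₁ φ-choice

    φ-edge : ∀ w → Tᵢ w ≡ true → edgeB G S (φ w) w ≡ true
    φ-edge w w∈ = proj₁ (proj₂ φ-choice w w∈)

    φ-closer : ∀ w → Tᵢ w ≡ true → dist (φ w) < dist w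
    φ-closer w w∈ = proj₂ (proj₂ φ-choice w w∈)

    φ-adj : ∀ w → Tᵢ w ≡ true → adj G (φ w) w ≡ true
    φ-adj w w∈ = ∧-true⁻ˡ (φ-edge w w∈)

    φ-Sᵢ : ∀ w → Tᵢ w ≡ true → Sᵢ (φ w) ≡ true
    φ-Sᵢ w w∈ = ∧-true⁺ (edgeB-S-side (φ w) w (φ-edge w w∈) (N[S]-disjoint w (Tᵢ⇒N[S] w w∈)))
                        (edgeB-VBˡ (φ w) w (φ-edge w w∈) (Tᵢ⇒VB w w∈))

    fibre : Fin n → VSet n
    fibre u w = Tᵢ w ∧ ⌊ φ w ≟F u ⌋

    fibre-bound : ∀ u → Sᵢ u ≡ true → u ≢ r → 1ℚ + ℕ→ℚ (count (fibre u)) ≤ ℕ→ℚ (deg G u)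
    fibre-bound u Sᵢu u≢r = count-insert fibre⊆N[u] uy y∉fibre
      where
      u-parent = parent u (∧-true⁻ʳ {S u} Sᵢu) u≢r
      y = proj₁ u-parent
      uy : adj G u y ≡ true
      uy = trans (sym G u y) (∧-true⁻ˡ (proj₁ (proj₂ u-parent)))
      y∈Tᵢ : Tᵢ y ≡ true
      y∈Tᵢ = N-true⁺ G Sᵢu uy
      φy≢u : φ y ≢ u
      φy≢u φy≡u = ℕₚ.<-asym (proj₂ (proj₂ u-parent)) (subst (λ x → dist x < dist y) φy≡u (φ-closer y y∈Tᵢ))
      y∉fibre : fibre u y ≡ false
      y∉fibre = trans (cong (Tᵢ y ∧_) (≟-false φy≢u)) (Boolₚ.∧-zeroʳ (Tᵢ y))
      fibre⊆N[u] : fibre u ⊆ adj G u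
      fibre⊆N[u] w w∈ = subst (λ x → adj G x w ≡ true) (≟-true⁻ (∧-true⁻ʳ {Tᵢ w} w∈)) (φ-adj w (∧-true⁻ˡ w∈))

    fibres-cover-Tᵢ : sumV Sᵢ (λ u → ℕ→ℚ (count (fibre u))) ≡ ℕ→ℚ (count Tᵢ)
    fibres-cover-Tᵢ = begin
      sumV Sᵢ (λ u → ℕ→ℚ (count (fibre u)))       ≡⟨ sumV-congʳ {P = Sᵢ} (λ u _ → ℚₚ.*-identityʳ _) ⟨
      sumV Sᵢ (λ u → ℕ→ℚ (count (fibre u)) * 1ℚ)  ≡⟨ sumV-fibres Tᵢ Sᵢ φ (λ _ → 1ℚ) φ-Sᵢ ⟨
      sumV Tᵢ (λ _ → 1ℚ)                          ≡⟨ sumV-1 Tᵢ ⟩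
      ℕ→ℚ (count Tᵢ)                              ∎
      where open ≡-Reasoning

    charge-to-parents : ∀ x → 0ℚ ≤ x →
      sumV (N[ G ] Sᵢ) (λ v → inv (ℕ→ℚ (ζ v) + x))
        ≤ sumV Sᵢ (λ u → (1ℚ + ℕ→ℚ (count (fibre u))) * inv (ℕ→ℚ (deg G u) + x))
    charge-to-parents x x≥0 = begin
      sumV (N[ G ] Sᵢ) f                                           ≡⟨ sumV-∪ Tᵢ Sᵢ f Tᵢ∩Sᵢ=∅ ⟩
      sumV Tᵢ f + sumV Sᵢ f                                        ≤⟨ ℚₚ.+-mono-≤ (sumV-mono Tᵢ-weight)
                                                                        (ℚₚ.≤-reflexive (sumV-congʳ {P = Sᵢ} Sᵢ-weight)) ⟩
      sumV Tᵢ (β ∘ φ) + sumV Sᵢ β                                  ≡⟨ cong (_+ sumV Sᵢ β) (sumV-fibres Tᵢ Sᵢ φ β φ-Sᵢ) ⟩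
      sumV Sᵢ (λ u → ℕ→ℚ (count (fibre u)) * β u) + sumV Sᵢ β     ≡⟨ sumV-+ Sᵢ (λ u → ℕ→ℚ (count (fibre u)) * β u) β ⟨
      sumV Sᵢ (λ u → ℕ→ℚ (count (fibre u)) * β u + β u)           ≡⟨ sumV-congʳ {P = Sᵢ} (λ u _ → regroup u) ⟩
      sumV Sᵢ (λ u → (1ℚ + ℕ→ℚ (count (fibre u))) * β u)          ∎
      where
      open ℚₚ.≤-Reasoning
      f β : Fin n → ℚ
      f v = inv (ℕ→ℚ (ζ v) + x)
      β u = inv (ℕ→ℚ (deg G u) + x)

      Sᵢ-weight : ∀ u → Sᵢ u ≡ true → f u ≡ β u
      Sᵢ-weight u Sᵢu = cong (λ k → inv (ℕ→ℚ k + x)) (proj₁ (S-cheap u (∧-true⁻ˡ Sᵢu)))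

      Tᵢ-weight : ∀ w → Tᵢ w ≡ true → f w ≤ β (φ w)
      Tᵢ-weight w w∈ = inv-antitone {ℕ→ℚ (deg G (φ w)) + x} {ℕ→ℚ (ζ w) + x}
                         (ℚₚ.<-≤-trans (count-pos {P = adj G (φ w)} (φ-adj w w∈)) (p≤p+q (ℕ→ℚ (deg G (φ w))) x≥0))
                         (ℚₚ.+-monoˡ-≤ x (ℕ→ℚ-mono-≤ deg-φw≤ζw))
        where
        φw-cheap = S-cheap (φ w) (∧-true⁻ˡ (φ-Sᵢ w w∈))
        deg-φw≤ζw = subst (ℕ._≤ ζ w) (proj₁ φw-cheap) (proj₂ φw-cheap w (inj₂ (φ-adj w w∈)))

      regroup : ∀ u → ℕ→ℚ (count (fibre u)) * β u + β u ≡ (1ℚ + ℕ→ℚ (count (fibre u))) * β u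
      regroup u = begin-equality
        ℕ→ℚ (count (fibre u)) * β u + β u         ≡⟨ cong (ℕ→ℚ (count (fibre u)) * β u +_) (ℚₚ.*-identityˡ (β u)) ⟨
        ℕ→ℚ (count (fibre u)) * β u + 1ℚ * β u    ≡⟨ ℚₚ.*-distribʳ-+ (β u) (ℕ→ℚ (count (fibre u))) 1ℚ ⟨
        (ℕ→ℚ (count (fibre u)) + 1ℚ) * β u        ≡⟨ cong (_* β u) (ℚₚ.+-comm (ℕ→ℚ (count (fibre u))) 1ℚ) ⟩
        (1ℚ + ℕ→ℚ (count (fibre u))) * β u        ∎

  edges≤degree-sum : ℕ→ℚ (eB G S comp i) ≤ sumV Sᵢ (λ u → ℕ→ℚ (deg G u))
  edges≤degree-sum = begin
    ℕ→ℚ (eB G S comp i)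
      ≡⟨ ℕ→ℚ-sum (λ u → count (λ v → u ≺ v ∧ Eᵢ u v)) ⟩
    ℚΣ.sum (λ u → ℕ→ℚ (count (λ v → u ≺ v ∧ Eᵢ u v)))
      ≡⟨ ℚΣ.sum-cong-≗ (λ u → sumV-1 (λ v → u ≺ v ∧ Eᵢ u v)) ⟨
    ℚΣ.sum (λ u → sumV (λ v → u ≺ v ∧ Eᵢ u v) (λ _ → 1ℚ))
      ≤⟨ unordered≤ordered Eᵢ (λ u v → Sᵢ u ∧ adj G u v) oriented ⟩
    ℚΣ.sum (λ u → sumV (λ v → Sᵢ u ∧ adj G u v) (λ _ → 1ℚ))
      ≡⟨ ℚΣ.sum-cong-≗ degree ⟩
    ℚΣ.sum (λ u → if Sᵢ u then ℕ→ℚ (deg G u) else 0ℚ)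
      ≡⟨ sumV≡∑ Sᵢ (λ u → ℕ→ℚ (deg G u)) ⟨
    sumV Sᵢ (λ u → ℕ→ℚ (deg G u)) ∎
    where
    open ℚₚ.≤-Reasoning
    _≺_ : Fin n → Fin n → Bool
    u ≺ v = ⌊ toℕ u ℕ.<? toℕ v ⌋
    Eᵢ : Fin n → Fin n → Bool
    Eᵢ u v = edgeB G S u v ∧ VB G S comp i u ∧ VB G S comp i v
    oriented : ∀ u v → Eᵢ u v ≡ true → Sᵢ u ∧ adj G u v ≡ true ⊎ Sᵢ v ∧ adj G v u ≡ true
    oriented u v uv∈ = ⊎-map (λ (Su , uv) → ∧-true⁺ (∧-true⁺ Su (∧-true⁻ˡ VB-uv)) uv)
                             (λ (Sv , vu) → ∧-true⁺ (∧-true⁺ Sv (∧-true⁻ʳ {VB G S comp i u} VB-uv)) vu)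
                             (edgeB⇒S-adj u v (∧-true⁻ˡ uv∈))
      where VB-uv = ∧-true⁻ʳ {edgeB G S u v} uv∈
    degree : ∀ u → sumV (λ v → Sᵢ u ∧ adj G u v) (λ _ → 1ℚ) ≡ (if Sᵢ u then ℕ→ℚ (deg G u) else 0ℚ)
    degree u = trans (sumV-guard (Sᵢ u) (adj G u) (λ _ → 1ℚ)) (cong (λ x → if Sᵢ u then x else 0ℚ) (sumV-1 (adj G u)))

  degree-balance : ℕ→ℚ (count Sᵢ) + ℕ→ℚ (count Tᵢ)
                   ≤ sumV Sᵢ (λ u → ℕ→ℚ (deg G u)) + ℕ→ℚ (count Sᵢ) * lam G S comp i
  degree-balance = begin
    ℕ→ℚ (count Sᵢ) + ℕ→ℚ (count Tᵢ)     ≡⟨ cong₂ (λ a b → ℕ→ℚ a + ℕ→ℚ b) count-Sᵢ count-Tᵢ ⟩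
    s + t                               ≤⟨ p≤p+q (s + t) (p≤q⇒0≤q-p edges≤degree-sum) ⟩
    s + t + (D - e)                     ≡⟨ solve 4 (λ D e s t → s :+ t :+ (D :- e) := D :+ (s :- e :+ t)) refl D e s t ⟩
    D + (s - e + t)                     ≡⟨ cong (D +_) (s*[1-e/s+t/s]≡s-e+t s e t s≢0) ⟨
    D + s * lam G S comp i              ≡⟨ cong (λ k → D + ℕ→ℚ k * lam G S comp i) count-Sᵢ ⟨
    D + ℕ→ℚ (count Sᵢ) * lam G S comp i ∎
    where
    open ℚₚ.≤-Reasoning
    open +-*-Solver
    s = ℕ→ℚ (sB G S comp i)
    t = ℕ→ℚ (tB G S comp i)
    e = ℕ→ℚ (eB G S comp i)
    D = sumV Sᵢ (λ u → ℕ→ℚ (deg G u))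
    s≢0 : s ≢ 0ℚ
    s≢0 s≡0 = ℚₚ.<-irrefl (≡.sym (trans (cong ℕ→ℚ count-Sᵢ) s≡0)) (count-pos {P = Sᵢ} (proj₂ Sᵢ-nonempty))

  component-bound : 0ℚ ≤ lam G S comp i →
    sumV (N[ G ] Sᵢ) (λ v → inv (ℕ→ℚ (ζ v) + lam G S comp i)) ≤ ℕ→ℚ (sB G S comp i)
  component-bound λ≥0 = begin
    sumV (N[ G ] Sᵢ) (λ v → inv (ℕ→ℚ (ζ v) + x))   ≤⟨ charge-to-parents x λ≥0 ⟩
    sumV Sᵢ (λ u → a u * inv (b u))                 ≤⟨ averaging Sᵢ r a b 0≤b-r b≤b-r a≤b Σa≤Σb ⟩
    ℕ→ℚ (count Sᵢ)                                  ≡⟨ cong ℕ→ℚ count-Sᵢ ⟩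
    ℕ→ℚ (sB G S comp i)                             ∎
    where
    open ℚₚ.≤-Reasoning
    x = lam G S comp i
    root = maximiser Sᵢ (deg G) (proj₂ Sᵢ-nonempty)
    r = proj₁ root
    open BFS r (proj₁ (proj₂ root))

    a b : Fin n → ℚ
    a u = 1ℚ + ℕ→ℚ (count (fibre u))
    b u = ℕ→ℚ (deg G u) + x

    0≤b-r : 0ℚ ≤ b r
    0≤b-r = ℚₚ.≤-trans (ℕ→ℚ-nonNeg (deg G r)) (p≤p+q (ℕ→ℚ (deg G r)) λ≥0)

    b≤b-r : ∀ u → Sᵢ u ≡ true → b u ≤ b r
    b≤b-r u Sᵢu = ℚₚ.+-monoˡ-≤ x (ℕ→ℚ-mono-≤ (proj₂ (proj₂ root) u Sᵢu))

    a≤b : ∀ u → Sᵢ u ≡ true → u ≢ r → 0ℚ ℚ.< a u × a u ≤ b u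
    a≤b u Sᵢu u≢r = ℚₚ.<-≤-trans 0<1 (p≤p+q 1ℚ (ℕ→ℚ-nonNeg (count (fibre u)))) ,
                    ℚₚ.≤-trans (fibre-bound u Sᵢu u≢r) (p≤p+q (ℕ→ℚ (deg G u)) λ≥0)

    Σa≤Σb : sumV Sᵢ a ≤ sumV Sᵢ b
    Σa≤Σb = begin
      sumV Sᵢ a                                                     ≡⟨ sumV-+ Sᵢ (λ _ → 1ℚ) (λ u → ℕ→ℚ (count (fibre u))) ⟩
      sumV Sᵢ (λ _ → 1ℚ) + sumV Sᵢ (λ u → ℕ→ℚ (count (fibre u)))   ≡⟨ cong₂ _+_ (sumV-1 Sᵢ) fibres-cover-Tᵢ ⟩
      ℕ→ℚ (count Sᵢ) + ℕ→ℚ (count Tᵢ)                               ≤⟨ degree-balance ⟩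
      D + ℕ→ℚ (count Sᵢ) * x                                        ≡⟨ cong (D +_) (sumV-const Sᵢ x) ⟨
      D + sumV Sᵢ (λ _ → x)                                         ≡⟨ sumV-+ Sᵢ (λ u → ℕ→ℚ (deg G u)) (λ _ → x) ⟨
      sumV Sᵢ b                                                     ∎
      where D = sumV Sᵢ (λ u → ℕ→ℚ (deg G u))

components-partition-S : ∀ {n p} (G : Graph n) (S : VSet n) (comp : Fin n → Fin p) →
  ℚΣ.sum (λ i → ℕ→ℚ (sB G S comp i)) ≡ ℕ→ℚ (count S)
components-partition-S G S comp = begin
  ℚΣ.sum (λ i → ℕ→ℚ (sB G S comp i))
    ≡⟨ ℚΣ.sum-cong-≗ (λ i → trans (sumV-congˡ {P = λ v → S v ∧ ⌊ comp v ≟F i ⌋} (λ v → ≡.sym (in-block i v))) (sumV-1 (λ v → VB G S comp i v ∧ S v))) ⟨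
  ℚΣ.sum (λ i → sumV (λ v → S v ∧ ⌊ comp v ≟F i ⌋) (λ _ → 1ℚ))
    ≡⟨ sumV-partition S comp (λ _ → 1ℚ) ⟩
  sumV S (λ _ → 1ℚ)
    ≡⟨ sumV-1 S ⟩
  ℕ→ℚ (count S) ∎
  where
  open ≡-Reasoning
  in-block : ∀ i v → VB G S comp i v ∧ S v ≡ S v ∧ ⌊ comp v ≟F i ⌋
  in-block i v = absorb (inB G S v) (S v) (∨-true⁺ˡ (N G S v))
    where
    absorb : ∀ a s → (s ≡ true → a ≡ true) → (a ∧ ⌊ comp v ≟F i ⌋) ∧ s ≡ s ∧ ⌊ comp v ≟F i ⌋
    absorb a false _ = Boolₚ.∧-zeroʳ (a ∧ ⌊ comp v ≟F i ⌋)
    absorb a true s⇒a rewrite s⇒a refl = Boolₚ.∧-identityʳ ⌊ comp v ≟F i ⌋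

theorem2 : ∀ {n} (G : Graph n) → 0 < n →
    (ζ : Fin n → ℕ) → (∀ v → IsZeta G v (ζ v)) →
    (S : VSet n) → MaximalIndepInCheap G ζ S →
    (p : ℕ) (comp : Fin n → Fin p) → IsComponentLabelling G S p comp →
    (∀ i → 0ℚ ≤ lam G S comp i) →
    (a : ℕ) → IsIndependenceNumber G a →
    bound G ζ S comp ≤ ℕ→ℚ a
theorem2 {n} G _ ζ ζ-spec S S-max p comp labelling λ≥0 a (_ , α-max) = begin
  bound G ζ S comp
    ≡⟨ cong (_+ sumV R weight) (sumℚ-allFin component-sum) ⟩
  ℚΣ.sum component-sum + sumV R weight
    ≤⟨ ℚₚ.+-mono-≤ (∑-mono-≤ (λ i → Component.component-bound G ζ S S-max comp labelling i (λ≥0 i))) I-heavy ⟩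
  ℚΣ.sum (λ i → ℕ→ℚ (sB G S comp i)) + ℕ→ℚ (count I)
    ≡⟨ cong (_+ ℕ→ℚ (count I)) (components-partition-S G S comp) ⟩
  ℕ→ℚ (count S) + ℕ→ℚ (count I)
    ≡⟨ count-∪ S I S∩I=∅ ⟨
  ℕ→ℚ (count (λ v → S v ∨ I v))
    ≤⟨ ℕ→ℚ-mono-≤ (α-max _ (independent-∪ G (proj₁ (proj₂ S-max)) I-indep S-I-non-adjacent)) ⟩
  ℕ→ℚ a ∎
  where
  open ℚₚ.≤-Reasoning
  open CaroWei G ζ ζ-spec
  component-sum : Fin p → ℚ
  component-sum i = sumV (N[ G ] (λ v → S v ∧ VB G S comp i v)) (λ v → inv (ℕ→ℚ (ζ v) + lam G S comp i))
  R : VSet n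
  R v = not (N[ G ] S v)
  I = proj₁ (heavy-independent-subset R)
  I-indep = proj₁ (proj₂ (heavy-independent-subset R))
  I⊆R = proj₁ (proj₂ (proj₂ (heavy-independent-subset R)))
  I-heavy = proj₂ (proj₂ (proj₂ (heavy-independent-subset R)))
  I∌N[S] : ∀ v → I v ≡ true → N G S v ∨ S v ≡ false
  I∌N[S] v Iv = not-true⁻ (I⊆R v Iv)
  S∩I=∅ : ∀ v → S v ≡ true → I v ≡ true → ⊥
  S∩I=∅ v Sv Iv = true≢false (trans (≡.sym (∨-true⁺ʳ (N G S v) Sv)) (I∌N[S] v Iv))
  S-I-non-adjacent : ∀ u v → S u ≡ true → I v ≡ true → adj G u v ≡ false
  S-I-non-adjacent u v Su Iv = ¬-not (λ uv → true≢false (trans (≡.sym (∨-true⁺ˡ (S v) (N-true⁺ G Su uv))) (I∌N[S] v Iv)))
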